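{- Let $n\geqslant 2$, $\mathbf{e}\in\mathbb{F}_2^n$, $\mathbf{a}\in\mathbb{F}_4^n$, and let $\tau$ be a group automorphism of $G_{\mathbf{e}}$ of order $4$ which is a generalized isometry (possibly an isometry) of $Q_{\mathbf{a}}$. If the action induced by $\tau$ on the quotient $G_{\mathbf{e}}/(\Phi(G_{\mathbf{e}})+\mathrm{Im}_{G_{\mathbf{e}}}(1+\tau^2))$ is non-trivial, then there exist a $\tau$-invariant subgroup $K$ of $G_{\mathbf{e}}$ of index $4$ and an element $h\in G_{\mathbf{e}}$ with $h_4\in K$ and $h_1,h_2,h_3\notin K$, where $h_i=h+\tau(h)+\cdots+\tau^{i-1}(h)$; hence $G_{K,\tau,h}=\langle R(K),R(h)\tau\rangle$ is a regular automorphism group of $\mathcal{S}^{(3)}_{\mathbf{e},\mathbf{a}}$ (of $\mathcal{S}^{(4)}_{\mathbf{e},\mathbf{a}}$ when $\tau$ is an isometry). The nilpotency class of $G_{K,\tau,h}$ is at most $6$.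
   Context: $\mathbb{F}_4=\{0,1,\omega,\omega+1\}$. For $\epsilon\in\mathbb{F}_2$, $G_\epsilon$ is the abelian group on $\mathbb{F}_4\times\mathbb{F}_4$ with $(x,y)+(x',y')=(x+x',\,y+y'+\epsilon(xx')^2)$; $Q_\alpha(x,y)=\alpha x^2+xy+y^2$. For $\mathbf{e}=(\epsilon_i)\in\mathbb{F}_2^n$, $\mathbf{a}=(\alpha_i)\in\mathbb{F}_4^n$: $G_{\mathbf{e}}=\bigoplus_i G_{\epsilon_i}$ (additive), $Q_{\mathbf{a}}((x_i,y_i)_i)=\sum_i Q_{\alpha_i}(x_i,y_i)$. $\tau$ is an isometry if $Q_{\mathbf{a}}(\tau(g))=Q_{\mathbf{a}}(g)$ for all $g$, a generalized isometry if $Q_{\mathbf{a}}(\tau(g))=\sigma(Q_{\mathbf{a}}(g))$ for all $g$ for some $\sigma\in\mathrm{Gal}(\mathbb{F}_4/\mathbb{F}_2)$. For $D\subseteq G_{\mathbf{e}}$ with $0\notin D=-D$, $\mathrm{Cay}(G_{\mathbf{e}},D)$ has $g_1\sim g_2$ iff $g_2-g_1\in D$. $\mathcal{S}^{(4)}_{\mathbf{e},\mathbf{a}}=(G_{\mathbf{e}};Q_{\mathbf{a}}^{ -1}(0)\setminus\{0\},Q_{\mathbf{a}}^{ -1}(1),Q_{\mathbf{a}}^{ -1}(\omega),Q_{\mathbf{a}}^{ -1}(\omega+1))$, $\mathcal{S}^{(3)}_{\mathbf{e},\mathbf{a}}=(G_{\mathbf{e}};Q_{\mathbf{a}}^{ -1}(0)\setminus\{0\},Q_{\mathbf{a}}^{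 -1}(1),Q_{\mathbf{a}}^{ -1}(\omega)\cup Q_{\mathbf{a}}^{ -1}(\omega+1))$; an automorphism of such a scheme is a permutation of $G_{\mathbf{e}}$ that is an automorphism of each of its Cayley graphs; regular means acting regularly on $G_{\mathbf{e}}$. $R(g):x\mapsto x+g$, $R(K)=\{R(g):g\in K\}$, composition right to left. $\mathrm{Im}_{G_{\mathbf{e}}}(f)=f(G_{\mathbf{e}})$ for an endomorphism $f$; $\Phi(G_{\mathbf{e}})=2G_{\mathbf{e}}$ is the Frattini subgroup (the subgroup $\Phi(G_{\mathbf{e}})+\mathrm{Im}_{G_{\mathbf{e}}}(1+\tau^2)$ is $\tau$-invariant). -}

module Defs where

open import Data.Nat using (ℕ; zero; suc; _≤_; _*_)
open import Data.Bool using (Bool; true; false)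
open import Data.Product using (_×_; _,_; Σ; ∃; ∃-syntax)
open import Data.Sum using (_⊎_)
open import Data.Vec using (Vec; []; _∷_)
open import Data.List using (List; []; _∷_; concatMap; map; length; filterᵇ)
open import Function using (id; _∘_)
open import Relation.Nullary using (¬_)
open import Relation.Binary.PropositionalEquality using (_≡_)

data F2 : Set where
  0₂ 1₂ : F2

data F4 : Set where
  𝟎 𝟏 ω ω+1 : F4

infixl 6 _⊕_
infixl 7 _⊗_

_⊕_ : F4 → F4 → F4
𝟎 ⊕ y = y
x ⊕ 𝟎 = x
𝟏 ⊕ 𝟏 = 𝟎
𝟏 ⊕ ω = ω+1
𝟏 ⊕ ω+1 = ω
ω ⊕ 𝟏 = ω+1
ω ⊕ ω = 𝟎
ω ⊕ ω+1 = 𝟏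
ω+1 ⊕ 𝟏 = ω
ω+1 ⊕ ω = 𝟏
ω+1 ⊕ ω+1 = 𝟎

_⊗_ : F4 → F4 → F4
𝟎 ⊗ y = 𝟎
𝟏 ⊗ y = y
ω ⊗ 𝟎 = 𝟎
ω ⊗ 𝟏 = ω
ω ⊗ ω = ω+1
ω ⊗ ω+1 = 𝟏
ω+1 ⊗ 𝟎 = 𝟎
ω+1 ⊗ 𝟏 = ω+1
ω+1 ⊗ ω = 𝟏
ω+1 ⊗ ω+1 = ω

sq : F4 → F4
sq x = x ⊗ x

ι : F2 → F4
ι 0₂ = 𝟎
ι 1₂ = 𝟏

frob : F4 → F4
frob = sq

Pair : Set
Pair = F4 × F4

addε : F2 → Pair → Pair → Pair
addε ε (x , y) (x' , y') = (x ⊕ x' , y ⊕ y' ⊕ ι ε ⊗ sq (x ⊗ x'))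

-- -(x,y) = (x, y + ε (x x)²)   (since (x,y)+(x,y+ε x⁴) = 0)
negε : F2 → Pair → Pair
negε ε (x , y) = (x , y ⊕ ι ε ⊗ sq (x ⊗ x))

G : ℕ → Set
G n = Vec Pair n

addG : ∀ {n} → Vec F2 n → G n → G n → G n
addG [] [] [] = []
addG (ε ∷ e) (p ∷ g) (q ∷ g') = addε ε p q ∷ addG e g g'

negG : ∀ {n} → Vec F2 n → G n → G n
negG [] [] = []
negG (ε ∷ e) (p ∷ g) = negε ε p ∷ negG e g

zeroG : ∀ {n} → G n
zeroG {zero} = []
zeroG {suc n} = (𝟎 , 𝟎) ∷ zeroG

allF4 : List F4
allF4 = 𝟎 ∷ 𝟏 ∷ ω ∷ ω+1 ∷ []

allPair : List Pair
allPair = concatMap (λ x → map (λ y → (x , y)) allF4) allF4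

allG : (n : ℕ) → List (G n)
allG zero = [] ∷ []
allG (suc n) = concatMap (λ p → map (p ∷_) (allG n)) allPair

Qα : F4 → Pair → F4
Qα α (x , y) = α ⊗ sq x ⊕ x ⊗ y ⊕ sq y

Q : ∀ {n} → Vec F4 n → G n → F4
Q [] [] = 𝟎
Q (α ∷ a) (p ∷ g) = Qα α p ⊕ Q a g

IsGroupAut : ∀ {n} → Vec F2 n → (G n → G n) → Set
IsGroupAut e τ =
  (∀ g g' → τ (addG e g g') ≡ addG e (τ g) (τ g'))
  × (∀ g g' → τ g ≡ τ g' → g ≡ g')
  × (∀ g → ∃[ g' ] τ g' ≡ g)

HasOrder4 : ∀ {n} → (G n → G n) → Set
HasOrder4 τ = (∀ g → τ (τ (τ (τ g))) ≡ g) × ¬ (∀ g → τ (τ g) ≡ g)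

IsIsometry : ∀ {n} → Vec F4 n → (G n → G n) → Set
IsIsometry a τ = ∀ g → Q a (τ g) ≡ Q a g

-- Gal(F₄/F₂) = {id, frob}
IsGenIsometry : ∀ {n} → Vec F4 n → (G n → G n) → Set
IsGenIsometry a τ =
  (∀ g → Q a (τ g) ≡ Q a g) ⊎ (∀ g → Q a (τ g) ≡ frob (Q a g))

-- membership in Φ(G_𝐞) + Im(1 + τ²) = {2u + (v + τ²v)}
InΦIm : ∀ {n} → Vec F2 n → (G n → G n) → G n → Set
InΦIm e τ x = ∃[ u ] ∃[ v ] x ≡ addG e (addG e u u) (addG e v (τ (τ v)))

NontrivialOnQuotient : ∀ {n} → Vec F2 n → (G n → G n) → Set
NontrivialOnQuotient e τ = ∃[ g ] ¬ InΦIm e τ (addG e (τ g) (negG e g))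

IsSubgroup : ∀ {n} → Vec F2 n → (G n → Bool) → Set
IsSubgroup e K =
  (K zeroG ≡ true)
  × (∀ g g' → K g ≡ true → K g' ≡ true → K (addG e g g') ≡ true)
  × (∀ g → K g ≡ true → K (negG e g) ≡ true)

IsInvariant : ∀ {n} → (G n → G n) → (G n → Bool) → Set
IsInvariant τ K = ∀ g → K g ≡ true → K (τ g) ≡ true

HasIndex4 : (n : ℕ) → (G n → Bool) → Set
HasIndex4 n K = length (allG n) ≡ 4 * length (filterᵇ K (allG n))

τpow : ∀ {n} → (G n → G n) → ℕ → G n → G n
τpow τ zero g = g
τpow τ (suc i) g = τ (τpow τ i g)

hSeq : ∀ {n} → Vec F2 n → (G n → G n) → G n → ℕ → G n
hSeq e τ h zero = zeroG
hSeq e τ h (suc i) = addG e (hSeq e τ h i) (τpow τ i h)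

-- Permutation groups on G_𝐞 (elements are maps G → G, compared pointwise)

IsInverse : ∀ {n} → (G n → G n) → (G n → G n) → Set
IsInverse f f' = (∀ x → f' (f x) ≡ x) × (∀ x → f (f' x) ≡ x)

data Gen {n} (S : (G n → G n) → Set) : (G n → G n) → Set where
  gen  : ∀ {f} → S f → Gen S f
  unit : Gen S id
  comp : ∀ {f g} → Gen S f → Gen S g → Gen S (f ∘ g)
  inv  : ∀ {f f'} → Gen S f → IsInverse f f' → Gen S f'
  ext  : ∀ {f g} → Gen S f → (∀ x → f x ≡ g x) → Gen S g

R : ∀ {n} → Vec F2 n → G n → G n → G n
R e g x = addG e x g

GKτhGens : ∀ {n} → Vec F2 n → (G n → Bool) → (G n → G n) → G n
         → (G n → G n) → Set
GKτhGens e K τ h f =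
  (Σ (G _) λ k → (K k ≡ true) × (∀ x → f x ≡ R e k x))
  ⊎ (∀ x → f x ≡ R e h (τ x))

GKτh : ∀ {n} → Vec F2 n → (G n → Bool) → (G n → G n) → G n
     → (G n → G n) → Set
GKτh e K τ h = Gen (GKτhGens e K τ h)

Comm : ∀ {n} → ((G n → G n) → Set) → ((G n → G n) → Set)
     → (G n → G n) → Set
Comm A B c = ∃[ x ] ∃[ y ] ∃[ x' ] ∃[ y' ]
  (A x × B y × IsInverse x x' × IsInverse y y'
   × (∀ z → c z ≡ x' (y' (x (y z)))))

-- lower central series: lcs H 0 = γ₁ = H, lcs H (i+1) = γ_{i+2} = [γ_{i+1}, H]
lcs : ∀ {n} → ((G n → G n) → Set) → ℕ → (G n → G n) → Set
lcs H zero = H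
lcs H (suc i) = Gen (Comm (lcs H i) H)

NilClassAtMost : ∀ {n} → ℕ → ((G n → G n) → Set) → Set
NilClassAtMost c H = ∀ f → lcs H c f → ∀ z → f z ≡ z

D4 : ∀ {n} → Vec F4 n → ℕ → G n → Set
D4 a 0 g = (Q a g ≡ 𝟎) × ¬ (g ≡ zeroG)
D4 a 1 g = Q a g ≡ 𝟏
D4 a 2 g = Q a g ≡ ω
D4 a _ g = Q a g ≡ ω+1

D3 : ∀ {n} → Vec F4 n → ℕ → G n → Set
D3 a 0 g = (Q a g ≡ 𝟎) × ¬ (g ≡ zeroG)
D3 a 1 g = Q a g ≡ 𝟏
D3 a _ g = (Q a g ≡ ω) ⊎ (Q a g ≡ ω+1)

IsCayAut : ∀ {n} → Vec F2 n → (G n → Set) → (G n → G n) → Set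
IsCayAut e D σ = ∀ g₁ g₂ →
  (D (addG e g₂ (negG e g₁)) → D (addG e (σ g₂) (negG e (σ g₁))))
  × (D (addG e (σ g₂) (negG e (σ g₁))) → D (addG e g₂ (negG e g₁)))

IsPerm : ∀ {n} → (G n → G n) → Set
IsPerm σ = (∀ g g' → σ g ≡ σ g' → g ≡ g') × (∀ g → ∃[ g' ] σ g' ≡ g)

IsSchemeAut : ∀ {n} → Vec F2 n → ℕ → (ℕ → G n → Set) → (G n → G n) → Set
IsSchemeAut e k D σ = IsPerm σ × (∀ i → suc i ≤ k → IsCayAut e (D i) σ)

IsRegular : ∀ {n} → ((G n → G n) → Set) → Set
IsRegular H =
  (∀ x y → ∃[ f ] (H f × f x ≡ y))
  × (∀ f f' x → H f → H f' → f x ≡ f' x → ∀ z → f z ≡ f' z)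

IsRegularAutGroup : ∀ {n} → Vec F2 n → ℕ → (ℕ → G n → Set)
                  → ((G n → G n) → Set) → Set
IsRegularAutGroup e k D H = (∀ f → H f → IsSchemeAut e k D f) × IsRegular H

-- Since G_𝐞 has exponent 4, W = Φ(G_𝐞) + Im(1 + τ²) contains 2G_𝐞, so a subgroup maximal among
-- those containing W but not v = τg − g is the kernel of a character χ : G_𝐞 → 𝔽₂ with χ ∘ τ² = χ
-- and χ(v) = 1. Then ψ = (χ, χ ∘ τ) maps G_𝐞 onto 𝔽₂², intertwining τ with the swap; its kernel K
-- is τ-invariant of index 4, ψ(h₄) = 0, and ψ(h₁), ψ(h₂), ψ(h₃) are the three nonzero values.
-- Every element of G_{K,τ,g} is an affine map x ↦ τⁱx + hᵢ + k with k ∈ K. Such a map sends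
-- differences y − x to τⁱ(y − x), so it preserves the classes of S⁽³⁾ (of S⁽⁴⁾ for an isometry);
-- the class ψ(hᵢ + k) determines i mod 4, which makes the action regular. Commutators of affine
-- maps are translations, by elements of Im(τ − 1)ʲ at depth j of the lower central series, and
-- (τ − 1)⁶ = 0 because τ⁴ = 1 and 4G_𝐞 = 0; hence the nilpotency class is at most 6.

module Submission where

open import Defs hiding (_⊕_)
open import Level using (0ℓ)
open import Algebra.Bundles using (CommutativeMonoid)
open import Data.Nat using (ℕ; zero; suc; _≤_; _*_) renaming (_+_ to _+ℕ_)
open import Data.Nat.Divisibility using (_∣_; divides)
open import Data.Nat.GeneralisedArithmetic using (fold)
import Data.Nat.Properties as ℕ
open import Data.Bool using (Bool; true; false; not; _∨_; _xor_; if_then_else_)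
open import Data.Bool.Properties using (xor-same; xor-identityʳ; ∨-zeroʳ)
open import Data.Fin using (Fin)
import Data.Fin as Fin
open import Data.Fin.Properties using (all?)
open import Data.Product using (_×_; _,_; proj₁; proj₂; Σ; ∃; ∃-syntax; swap)
import Data.Product.Properties as ×
open import Data.Sum using (_⊎_; inj₁; inj₂)
open import Data.Vec using (Vec; []; _∷_)
import Data.Vec.Properties as Vec
open import Data.List using (List; []; _∷_; _++_; concatMap; map; length; filterᵇ)
open import Data.List.Membership.Propositional using (_∈_; lose)
open import Data.List.Relation.Unary.Any using (here; there; any?; satisfied)
open import Data.Empty using (⊥-elim)
open import Function using (_∘_)
open import Relation.Nullary using (Dec; yes; no; ¬_; does)
open import Relation.Nullary.Decidable using (map′; toWitness; dec-true; dec-false)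
open import Relation.Binary.Definitions using (DecidableEquality)
open import Relation.Binary.PropositionalEquality
open import Algebra.Properties.CommutativeSemigroup ℕ.+-commutativeSemigroup using () renaming (interchange to +ℕ-interchange)

true≢false : true ≢ false
true≢false ()

xor≡false⇒≡ : ∀ {p q} → p xor q ≡ false → p ≡ q
xor≡false⇒≡ {true} {true} _ = refl
xor≡false⇒≡ {false} {false} _ = refl

xor≡true⇒≡not : ∀ {p q} → p xor q ≡ true → p ≡ not q
xor≡true⇒≡not {true} {false} _ = refl
xor≡true⇒≡not {false} {true} _ = refl

F4→Fin4 : F4 → Fin 4
F4→Fin4 𝟎 = Fin.zero
F4→Fin4 𝟏 = Fin.suc Fin.zero
F4→Fin4 ω = Fin.suc (Fin.suc Fin.zero)
F4→Fin4 ω+1 = Fin.suc (Fin.suc (Fin.suc Fin.zero))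

Fin4→F4 : Fin 4 → F4
Fin4→F4 Fin.zero = 𝟎
Fin4→F4 (Fin.suc Fin.zero) = 𝟏
Fin4→F4 (Fin.suc (Fin.suc Fin.zero)) = ω
Fin4→F4 (Fin.suc (Fin.suc (Fin.suc Fin.zero))) = ω+1

Fin4→F4∘F4→Fin4 : ∀ x → Fin4→F4 (F4→Fin4 x) ≡ x
Fin4→F4∘F4→Fin4 𝟎 = refl
Fin4→F4∘F4→Fin4 𝟏 = refl
Fin4→F4∘F4→Fin4 ω = refl
Fin4→F4∘F4→Fin4 ω+1 = refl

_≟F4_ : DecidableEquality F4
x ≟F4 y = map′ F4→Fin4-injective (cong F4→Fin4) (F4→Fin4 x Fin.≟ F4→Fin4 y)
  where
  F4→Fin4-injective : F4→Fin4 x ≡ F4→Fin4 y → x ≡ y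
  F4→Fin4-injective eq =
    trans (sym (Fin4→F4∘F4→Fin4 x)) (trans (cong Fin4→F4 eq) (Fin4→F4∘F4→Fin4 y))

_≟P_ : DecidableEquality Pair
_≟P_ = ×.≡-dec _≟F4_ _≟F4_

_≟G_ : ∀ {n} → DecidableEquality (G n)
_≟G_ = Vec.≡-dec _≟P_

∀F2? : {P : F2 → Set} → (∀ ε → Dec (P ε)) → Dec (∀ ε → P ε)
∀F2? P? with P? 0₂ | P? 1₂
... | yes p | yes q = yes λ { 0₂ → p ; 1₂ → q }
... | no ¬p | _ = no λ ∀P → ¬p (∀P 0₂)
... | yes _ | no ¬q = no λ ∀P → ¬q (∀P 1₂)

∀F4? : {P : F4 → Set} → (∀ x → Dec (P x)) → Dec (∀ x → P x)
∀F4? {P} P? = map′ (λ ∀P x → subst P (Fin4→F4∘F4→Fin4 x) (∀P (F4→Fin4 x)))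
                   (λ ∀P i → ∀P (Fin4→F4 i))
                   (all? (P? ∘ Fin4→F4))

∀Pair? : {P : Pair → Set} → (∀ p → Dec (P p)) → Dec (∀ p → P p)
∀Pair? P? = map′ (λ ∀P (x , y) → ∀P x y) (λ ∀P x y → ∀P (x , y))
                 (∀F4? λ x → ∀F4? λ y → P? (x , y))

-- The group laws of G_ε are finitely many identities in F₄, checked by evaluation.

addε-assoc : ∀ ε p q r → addε ε (addε ε p q) r ≡ addε ε p (addε ε q r)
addε-assoc = toWitness {a? = ∀F2? λ ε → ∀Pair? λ p → ∀Pair? λ q → ∀Pair? λ r →
  addε ε (addε ε p q) r ≟P addε ε p (addε ε q r)} _

addε-comm : ∀ ε p q → addε ε p q ≡ addε ε q p
addε-comm = toWitness {a? = ∀F2? λ ε → ∀Pair? λ p → ∀Pair? λ q →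
  addε ε p q ≟P addε ε q p} _

addε-identityˡ : ∀ ε p → addε ε (𝟎 , 𝟎) p ≡ p
addε-identityˡ = toWitness {a? = ∀F2? λ ε → ∀Pair? λ p → addε ε (𝟎 , 𝟎) p ≟P p} _

negε≡triple : ∀ ε p → negε ε p ≡ addε ε (addε ε p p) p
negε≡triple = toWitness {a? = ∀F2? λ ε → ∀Pair? λ p →
  negε ε p ≟P addε ε (addε ε p p) p} _

addε-exponent4 : ∀ ε p → addε ε (addε ε (addε ε p p) p) p ≡ (𝟎 , 𝟎)
addε-exponent4 = toWitness {a? = ∀F2? λ ε → ∀Pair? λ p →
  addε ε (addε ε (addε ε p p) p) p ≟P (𝟎 , 𝟎)} _

module Group {n : ℕ} (e : Vec F2 n) where

  infixl 6 _+_
  _+_ : G n → G n → G n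
  _+_ = addG e

  0ᴳ : G n
  0ᴳ = zeroG

  -- −x = 3x in exponent 4; in this form negation is visible to the commutative-monoid solver.
  infix 8 -_
  -_ : G n → G n
  - x = x + x + x

  +-assoc : ∀ x y z → x + y + z ≡ x + (y + z)
  +-assoc = go e
    where
    go : ∀ {m} (e : Vec F2 m) x y z → addG e (addG e x y) z ≡ addG e x (addG e y z)
    go [] [] [] [] = refl
    go (ε ∷ e) (p ∷ x) (q ∷ y) (r ∷ z) = cong₂ _∷_ (addε-assoc ε p q r) (go e x y z)

  +-comm : ∀ x y → x + y ≡ y + x
  +-comm = go e
    where
    go : ∀ {m} (e : Vec F2 m) x y → addG e x y ≡ addG e y x
    go [] [] [] = refl
    go (ε ∷ e) (p ∷ x) (q ∷ y) = cong₂ _∷_ (addε-comm ε p q) (go e x y)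

  +-identityˡ : ∀ x → 0ᴳ + x ≡ x
  +-identityˡ = go e
    where
    go : ∀ {m} (e : Vec F2 m) x → addG e zeroG x ≡ x
    go [] [] = refl
    go (ε ∷ e) (p ∷ x) = cong₂ _∷_ (addε-identityˡ ε p) (go e x)

  +-identityʳ : ∀ x → x + 0ᴳ ≡ x
  +-identityʳ x = trans (+-comm x 0ᴳ) (+-identityˡ x)

  negG≡- : ∀ x → negG e x ≡ - x
  negG≡- = go e
    where
    go : ∀ {m} (e : Vec F2 m) x → negG e x ≡ addG e (addG e x x) x
    go [] [] = refl
    go (ε ∷ e) (p ∷ x) = cong₂ _∷_ (negε≡triple ε p) (go e x)

  +-inverseʳ : ∀ x → x + - x ≡ 0ᴳ
  +-inverseʳ x = trans (sym (+-assoc x (x + x) x))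
    (trans (cong (_+ x) (sym (+-assoc x x x))) (go e x))
    where
    go : ∀ {m} (e : Vec F2 m) x → addG e (addG e (addG e x x) x) x ≡ zeroG
    go [] [] = refl
    go (ε ∷ e) (p ∷ x) = cong₂ _∷_ (addε-exponent4 ε p) (go e x)

  commutativeMonoid : CommutativeMonoid 0ℓ 0ℓ
  commutativeMonoid = record
    { Carrier = G n
    ; _≈_ = _≡_
    ; _∙_ = _+_
    ; ε = 0ᴳ
    ; isCommutativeMonoid = record
      { isMonoid = record
        { isSemigroup = record
          { isMagma = record { isEquivalence = isEquivalence ; ∙-cong = cong₂ _+_ }
          ; assoc = +-assoc }
        ; identity = +-identityˡ , +-identityʳ }
      ; comm = +-comm } }

  open import Algebra.Solver.CommutativeMonoid commutativeMonoid public using (solve; _⊜_; Expr)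
  import Algebra.Solver.CommutativeMonoid commutativeMonoid as Solver

  infixl 6 _⊞_
  _⊞_ : ∀ {k} → Expr k → Expr k → Expr k
  _⊞_ = Solver._⊕_

  x+y-y≡x : ∀ x y → x + y + - y ≡ x
  x+y-y≡x x y = trans (+-assoc x y (- y)) (trans (cong (x +_) (+-inverseʳ y)) (+-identityʳ x))

  x-y+y≡x : ∀ x y → x + - y + y ≡ x
  x-y+y≡x x y = trans (+-assoc x (- y) y)
    (trans (cong (x +_) (trans (+-comm (- y) y) (+-inverseʳ y))) (+-identityʳ x))

  x+4y≡x : ∀ x y → x + (y + y + y + y) ≡ x
  x+4y≡x x y = trans (cong (x +_) (trans (+-comm (y + y + y) y) (+-inverseʳ y))) (+-identityʳ x)

  +-cancelʳ : ∀ {x y} z → x + z ≡ y + z → x ≡ y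
  +-cancelʳ {x} {y} z eq = trans (sym (x+y-y≡x x z)) (trans (cong (_+ - z) eq) (x+y-y≡x y z))

private
  variable
    A B : Set

∑ : List A → (A → ℕ) → ℕ
∑ [] f = 0
∑ (x ∷ L) f = f x +ℕ ∑ L f

∑-zero : ∀ (L : List A) → ∑ L (λ _ → 0) ≡ 0
∑-zero [] = refl
∑-zero (_ ∷ L) = ∑-zero L

∑-++ : ∀ (L L' : List A) f → ∑ (L ++ L') f ≡ ∑ L f +ℕ ∑ L' f
∑-++ [] L' f = refl
∑-++ (x ∷ L) L' f = trans (cong (f x +ℕ_) (∑-++ L L' f)) (sym (ℕ.+-assoc (f x) _ _))

∑-cong : ∀ (L : List A) {f g : A → ℕ} → (∀ x → f x ≡ g x) → ∑ L f ≡ ∑ L g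
∑-cong [] eq = refl
∑-cong (x ∷ L) eq = cong₂ _+ℕ_ (eq x) (∑-cong L eq)

∑-+ : ∀ (L : List A) f g → ∑ L (λ x → f x +ℕ g x) ≡ ∑ L f +ℕ ∑ L g
∑-+ [] f g = refl
∑-+ (x ∷ L) f g = trans (cong (f x +ℕ g x +ℕ_) (∑-+ L f g))
  (+ℕ-interchange (f x) (g x) (∑ L f) (∑ L g))

∑-*ˡ : ∀ (L : List A) c f → ∑ L (λ x → c * f x) ≡ c * ∑ L f
∑-*ˡ [] c f = sym (ℕ.*-zeroʳ c)
∑-*ˡ (x ∷ L) c f = trans (cong (c * f x +ℕ_) (∑-*ˡ L c f)) (sym (ℕ.*-distribˡ-+ c (f x) _))

∑-swap : ∀ (L : List A) (L' : List B) (f : A → B → ℕ)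
       → ∑ L (λ x → ∑ L' (f x)) ≡ ∑ L' (λ y → ∑ L (λ x → f x y))
∑-swap [] L' f = sym (∑-zero L')
∑-swap (x ∷ L) L' f =
  trans (cong (∑ L' (f x) +ℕ_) (∑-swap L L' f)) (sym (∑-+ L' (f x) (λ y → ∑ L (λ x → f x y))))

∑-concatMap : ∀ (L : List B) (k : B → List A) f
            → ∑ (concatMap k L) f ≡ ∑ L (λ y → ∑ (k y) f)
∑-concatMap [] k f = refl
∑-concatMap (y ∷ L) k f =
  trans (∑-++ (k y) (concatMap k L) f) (cong (∑ (k y) f +ℕ_) (∑-concatMap L k f))

∑-map : ∀ (L : List B) (k : B → A) f → ∑ (map k L) f ≡ ∑ L (f ∘ k)
∑-map [] k f = refl
∑-map (y ∷ L) k f = cong (f (k y) +ℕ_) (∑-map L k f)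

𝟙 : Bool → ℕ
𝟙 b = if b then 1 else 0

length-filterᵇ : ∀ (P : A → Bool) L → length (filterᵇ P L) ≡ ∑ L (𝟙 ∘ P)
length-filterᵇ P [] = refl
length-filterᵇ P (x ∷ L) with P x
... | true = cong suc (length-filterᵇ P L)
... | false = length-filterᵇ P L

length≡∑1 : ∀ (L : List A) → length L ≡ ∑ L (λ _ → 1)
length≡∑1 [] = refl
length≡∑1 (x ∷ L) = cong suc (length≡∑1 L)

module Enumeration (_≟_ : DecidableEquality A) where

  δ : A → A → ℕ
  δ x y = 𝟙 (does (y ≟ x))

  Enumerates : List A → Set
  Enumerates L = ∀ x → ∑ L (δ x) ≡ 1

  module _ {L : List A} (enum : Enumerates L) where

    ∑-δ : ∀ w (f : A → ℕ) → ∑ L (λ z → δ w z * f z) ≡ f w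
    ∑-δ w f = begin
      ∑ L (λ z → δ w z * f z)  ≡⟨ ∑-cong L δ*f≡f*δ ⟩
      ∑ L (λ z → f w * δ w z)  ≡⟨ ∑-*ˡ L (f w) (δ w) ⟩
      f w * ∑ L (δ w)          ≡⟨ cong (f w *_) (enum w) ⟩
      f w * 1                  ≡⟨ ℕ.*-identityʳ (f w) ⟩
      f w                      ∎
      where
      open ≡-Reasoning
      δ*f≡f*δ : ∀ z → δ w z * f z ≡ f w * δ w z
      δ*f≡f*δ z with z ≟ w
      ... | yes refl = trans (ℕ.+-identityʳ (f z)) (sym (ℕ.*-identityʳ (f z)))
      ... | no _ = sym (ℕ.*-zeroʳ (f w))

    ∑-reindex : (t s : A → A) → (∀ x → s (t x) ≡ x) → (∀ y → t (s y) ≡ y)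
              → ∀ (f : A → ℕ) → ∑ L (f ∘ t) ≡ ∑ L f
    ∑-reindex t s s∘t t∘s f = begin
      ∑ L (λ x → f (t x))                     ≡⟨ ∑-cong L (λ x → sym (∑-δ (t x) f)) ⟩
      ∑ L (λ x → ∑ L (λ y → δ (t x) y * f y)) ≡⟨ ∑-swap L L _ ⟩
      ∑ L (λ y → ∑ L (λ x → δ (t x) y * f y)) ≡⟨ ∑-cong L (λ y → ∑-cong L (λ x → cong (_* f y) (δ-transpose x y))) ⟩
      ∑ L (λ y → ∑ L (λ x → δ (s y) x * f y)) ≡⟨ ∑-cong L (λ y → ∑-δ (s y) (λ _ → f y)) ⟩
      ∑ L f                                   ∎
      where
      open ≡-Reasoning
      δ-transpose : ∀ x y → δ (t x) y ≡ δ (s y) x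
      δ-transpose x y with y ≟ t x | x ≟ s y
      ... | yes _ | yes _ = refl
      ... | no _ | no _ = refl
      ... | yes y≡tx | no x≢sy = ⊥-elim (x≢sy (trans (sym (s∘t x)) (cong s (sym y≡tx))))
      ... | no y≢tx | yes x≡sy = ⊥-elim (y≢tx (trans (sym (t∘s y)) (cong t (sym x≡sy))))

    ∈-enumeration : ∀ x → x ∈ L
    ∈-enumeration x = go L (enum x)
      where
      go : ∀ L → ∑ L (δ x) ≡ 1 → x ∈ L
      go (y ∷ L) ∑≡1 with y ≟ x
      ... | yes refl = here refl
      ... | no _ = there (go L ∑≡1)

open Enumeration using (Enumerates; ∑-reindex; ∈-enumeration)

does≡true⇒ : ∀ {P : Set} (P? : Dec P) → does P? ≡ true → P
does≡true⇒ (yes p) _ = p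
does≡true⇒ (no _) ()

∃-dec : ∀ {L : List A} → (∀ x → x ∈ L) → {P : A → Set} → (∀ x → Dec (P x)) → Dec (∃ P)
∃-dec {L = L} complete P? = map′ satisfied (λ (x , Px) → lose (complete x) Px) (any? P? L)

allPair-enumerates : Enumerates _≟P_ allPair
allPair-enumerates = toWitness {a? = ∀Pair? λ p → ∑ allPair (Enumeration.δ _≟P_ p) ℕ.≟ 1} _

allG-enumerates : ∀ n → Enumerates _≟G_ (allG n)
allG-enumerates zero [] = refl
allG-enumerates (suc n) (p ∷ g) = begin
  ∑ (concatMap (λ p′ → map (p′ ∷_) (allG n)) allPair) (δ (p ∷ g))
    ≡⟨ ∑-concatMap allPair (λ p′ → map (p′ ∷_) (allG n)) (δ (p ∷ g)) ⟩
  ∑ allPair (λ p′ → ∑ (map (p′ ∷_) (allG n)) (δ (p ∷ g)))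
    ≡⟨ ∑-cong allPair (λ p′ → ∑-map (allG n) (p′ ∷_) (δ (p ∷ g))) ⟩
  ∑ allPair (λ p′ → ∑ (allG n) (λ y → δ (p ∷ g) (p′ ∷ y)))
    ≡⟨ ∑-cong allPair (λ p′ → trans (∑-cong (allG n) (δ-∷ p′) ) (∑-*ˡ (allG n) (δᴾ p p′) (δⁿ g))) ⟩
  ∑ allPair (λ p′ → δᴾ p p′ * ∑ (allG n) (δⁿ g))
    ≡⟨ ∑-cong allPair {g = δᴾ p} (λ p′ → trans (cong (δᴾ p p′ *_) (allG-enumerates n g)) (ℕ.*-identityʳ _)) ⟩
  ∑ allPair (δᴾ p)
    ≡⟨ allPair-enumerates p ⟩
  1 ∎
  where
  open ≡-Reasoning
  open Enumeration (_≟G_ {suc n}) using (δ)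
  open Enumeration (_≟G_ {n}) using () renaming (δ to δⁿ)
  open Enumeration _≟P_ using () renaming (δ to δᴾ)
  δ-∷ : ∀ p′ y → δ (p ∷ g) (p′ ∷ y) ≡ δᴾ p p′ * δⁿ g y
  δ-∷ p′ y with p′ ≟P p | y ≟G g
  ... | yes refl | yes refl = refl
  ... | yes refl | no _ = refl
  ... | no _ | _ = refl

∑-allG-reindex : ∀ n (t s : G n → G n) → (∀ x → s (t x) ≡ x) → (∀ y → t (s y) ≡ y)
               → ∀ (f : G n → ℕ) → ∑ (allG n) (f ∘ t) ≡ ∑ (allG n) f
∑-allG-reindex n = ∑-reindex _≟G_ {allG n} (allG-enumerates n)

∈-allG : ∀ n x → x ∈ allG n
∈-allG n = ∈-enumeration _≟G_ {allG n} (allG-enumerates n)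

module Characters {n : ℕ} (e : Vec F2 n) where

  open Group e

  IsCharacter : (G n → Bool) → Set
  IsCharacter χ = ∀ x y → χ (x + y) ≡ χ x xor χ y

  module _ {χ : G n → Bool} (χ-hom : IsCharacter χ) where

    χ-double : ∀ x → χ (x + x) ≡ false
    χ-double x = trans (χ-hom x x) (xor-same (χ x))

    χ-0ᴳ : χ 0ᴳ ≡ false
    χ-0ᴳ = trans (cong χ (sym (+-identityˡ 0ᴳ))) (χ-double 0ᴳ)

    χ-neg : ∀ x → χ (- x) ≡ χ x
    χ-neg x = trans (χ-hom (x + x) x) (cong (_xor χ x) (χ-double x))

  record AvoidingSubgroup (v : G n) (M : G n → Bool) : Set where
    field
      +-closed : ∀ x y → M x ≡ true → M y ≡ true → M (x + y) ≡ true
      doubles : ∀ x → M (x + x) ≡ true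
      avoids : M v ≡ false

    neg-closed : ∀ x → M x ≡ true → M (- x) ≡ true
    neg-closed x Mx = +-closed (x + x) x (doubles x) Mx

    difference : ∀ x y → M x ≡ true → M (x + y) ≡ true → M y ≡ true
    difference x y Mx Mxy = subst (λ z → M z ≡ true) eq (+-closed _ _ Mxy (neg-closed x Mx))
      where
      eq : x + y + - x ≡ y
      eq = trans (cong (_+ - x) (+-comm x y)) (x+y-y≡x y x)

    maximal⇒character : (∀ w → M w ≡ true ⊎ M (v + w) ≡ true) → IsCharacter (not ∘ M)
    maximal⇒character maximal x y with M x in Mx | M y in My
    ... | true | true rewrite +-closed x y Mx My = refl
    ... | true | false with M (x + y) in Mxy
    ...   | true = ⊥-elim (true≢false (trans (sym (difference x y Mx Mxy)) My))
    ...   | false = refl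
    maximal⇒character maximal x y | false | true with M (x + y) in Mxy
    ...   | true = ⊥-elim (true≢false (trans (sym (difference y x My (subst (λ z → M z ≡ true) (+-comm x y) Mxy))) Mx))
    ...   | false = refl
    maximal⇒character maximal x y | false | false with maximal x | maximal y
    ...   | inj₁ Mx′ | _ = ⊥-elim (true≢false (trans (sym Mx′) Mx))
    ...   | _ | inj₁ My′ = ⊥-elim (true≢false (trans (sym My′) My))
    ...   | inj₂ Mvx | inj₂ Mvy = cong not (subst (λ z → M z ≡ true) v+x+v+y+2v≡x+y
                                      (+-closed _ _ (+-closed _ _ Mvx Mvy) (doubles v)))
      where
      v+x+v+y+2v≡x+y : v + x + (v + y) + (v + v) ≡ x + y
      v+x+v+y+2v≡x+y = trans
        (solve 3 (λ v x y → v ⊞ x ⊞ (v ⊞ y) ⊞ (v ⊞ v) ⊜ x ⊞ y ⊞ (v ⊞ v ⊞ v) ⊞ v) refl v x y)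
        (x-y+y≡x (x + y) v)

  open AvoidingSubgroup

  -- M ∪ (M + x) is a subgroup since 2x ∈ M; it avoids v unless v + x ∈ M.
  adjoin : G n → (G n → Bool) → G n → G n → Bool
  adjoin v M x y = if M (v + x) then M y else (M y ∨ M (y + x))

  private
    ∨-introˡ : ∀ {a} b → a ≡ true → a ∨ b ≡ true
    ∨-introˡ b refl = refl

    ∨-introʳ : ∀ a {b} → b ≡ true → a ∨ b ≡ true
    ∨-introʳ a refl = ∨-zeroʳ a

    ∨-elim : ∀ a b → a ∨ b ≡ true → a ≡ true ⊎ b ≡ true
    ∨-elim true b _ = inj₁ refl
    ∨-elim false b eq = inj₂ eq

  adjoin-⊇ : ∀ v M x y → M y ≡ true → adjoin v M x y ≡ true
  adjoin-⊇ v M x y My with M (v + x)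
  ... | true = My
  ... | false = ∨-introˡ _ My

  adjoin-avoiding : ∀ {v M} x → AvoidingSubgroup v M → AvoidingSubgroup v (adjoin v M x)
  adjoin-avoiding {v} {M} x avoiding with M (v + x) in Mvx
  ... | true = avoiding
  ... | false = record
    { +-closed = closed
    ; doubles = λ w → ∨-introˡ _ (doubles avoiding w)
    ; avoids = trans (cong (_∨ M (v + x)) (avoids avoiding)) Mvx }
    where
    open AvoidingSubgroup avoiding using () renaming (+-closed to M-closed)
    M-closed≡ : ∀ {y z w} → M y ≡ true → M z ≡ true → y + z ≡ w → M w ≡ true
    M-closed≡ My Mz refl = M-closed _ _ My Mz
    closed : ∀ y z → M y ∨ M (y + x) ≡ true → M z ∨ M (z + x) ≡ true
           → M (y + z) ∨ M (y + z + x) ≡ true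
    closed y z My′ Mz′ with ∨-elim _ _ My′ | ∨-elim _ _ Mz′
    ... | inj₁ My | inj₁ Mz = ∨-introˡ _ (M-closed _ _ My Mz)
    ... | inj₁ My | inj₂ Mzx = ∨-introʳ _ (M-closed≡ My Mzx (sym (+-assoc y z x)))
    ... | inj₂ Myx | inj₁ Mz = ∨-introʳ _
      (M-closed≡ Myx Mz (solve 3 (λ y x z → y ⊞ x ⊞ z ⊜ y ⊞ z ⊞ x) refl y x z))
    ... | inj₂ Myx | inj₂ Mzx = ∨-introˡ _
      (M-closed≡ (M-closed _ _ Myx Mzx) (doubles avoiding x)
        (trans (solve 3 (λ y x z → y ⊞ x ⊞ (z ⊞ x) ⊞ (x ⊞ x) ⊜ y ⊞ z ⊞ (x ⊞ x ⊞ x) ⊞ x) refl y x z)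
               (x-y+y≡x (y + z) x)))

  adjoin-decides : ∀ {v M} x → AvoidingSubgroup v M
                 → adjoin v M x x ≡ true ⊎ adjoin v M x (v + x) ≡ true
  adjoin-decides {v} {M} x avoiding with M (v + x) in Mvx
  ... | true = inj₂ refl
  ... | false = inj₁ (∨-introʳ _ (doubles avoiding x))

  saturate : G n → List (G n) → (G n → Bool) → G n → Bool
  saturate v [] M = M
  saturate v (x ∷ xs) M = adjoin v (saturate v xs M) x

  module _ {v : G n} {M : G n → Bool} (avoiding : AvoidingSubgroup v M) where

    saturate-avoiding : ∀ xs → AvoidingSubgroup v (saturate v xs M)
    saturate-avoiding [] = avoiding
    saturate-avoiding (x ∷ xs) = adjoin-avoiding x (saturate-avoiding xs)

    saturate-⊇ : ∀ xs y → M y ≡ true → saturate v xs M y ≡ true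
    saturate-⊇ [] y My = My
    saturate-⊇ (x ∷ xs) y My = adjoin-⊇ v (saturate v xs M) x y (saturate-⊇ xs y My)

    saturate-decides : ∀ xs w → w ∈ xs → saturate v xs M w ≡ true ⊎ saturate v xs M (v + w) ≡ true
    saturate-decides (x ∷ xs) w (here refl) = adjoin-decides x (saturate-avoiding xs)
    saturate-decides (x ∷ xs) w (there w∈xs) with saturate-decides xs w w∈xs
    ... | inj₁ Mw = inj₁ (adjoin-⊇ v (saturate v xs M) x w Mw)
    ... | inj₂ Mvw = inj₂ (adjoin-⊇ v (saturate v xs M) x (v + w) Mvw)

    separatingCharacter : Σ (G n → Bool) λ χ →
      IsCharacter χ × χ v ≡ true × (∀ x → M x ≡ true → χ x ≡ false)
    separatingCharacter =
      not ∘ M′ ,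
      maximal⇒character (saturate-avoiding L) (λ w → saturate-decides L w (∈-allG n w)) ,
      cong not (avoids (saturate-avoiding L)) ,
      λ x Mx → cong not (saturate-⊇ L x Mx)
      where
      L : List (G n)
      L = allG n
      M′ : G n → Bool
      M′ = saturate v L M

module Automorphism {n : ℕ} (e : Vec F2 n) (τ : G n → G n)
  (τ-hom : ∀ x y → τ (addG e x y) ≡ addG e (τ x) (τ y))
  (τ-injective : ∀ x y → τ x ≡ τ y → x ≡ y)
  (τ⁴≡id : ∀ x → τ (τ (τ (τ x))) ≡ x) where

  open Group e

  τ^_ : ℕ → G n → G n
  τ^_ = τpow τ

  τ-0ᴳ : τ 0ᴳ ≡ 0ᴳ
  τ-0ᴳ = +-cancelʳ (τ 0ᴳ) (trans (sym (τ-hom 0ᴳ 0ᴳ)) (trans (cong τ (+-identityˡ 0ᴳ)) (sym (+-identityˡ (τ 0ᴳ)))))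

  τ-neg : ∀ x → τ (- x) ≡ - τ x
  τ-neg x = trans (τ-hom (x + x) x) (cong (_+ τ x) (τ-hom x x))

  τ^-hom : ∀ i x y → (τ^ i) (x + y) ≡ (τ^ i) x + (τ^ i) y
  τ^-hom zero x y = refl
  τ^-hom (suc i) x y = trans (cong τ (τ^-hom i x y)) (τ-hom _ _)

  τ^-0ᴳ : ∀ i → (τ^ i) 0ᴳ ≡ 0ᴳ
  τ^-0ᴳ zero = refl
  τ^-0ᴳ (suc i) = trans (cong τ (τ^-0ᴳ i)) τ-0ᴳ

  τ^-neg : ∀ i x → (τ^ i) (- x) ≡ - (τ^ i) x
  τ^-neg i x = trans (τ^-hom i (x + x) x) (cong (_+ (τ^ i) x) (τ^-hom i x x))

  τ^-+ : ∀ i j x → (τ^ (i +ℕ j)) x ≡ (τ^ i) ((τ^ j) x)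
  τ^-+ zero j x = refl
  τ^-+ (suc i) j x = cong τ (τ^-+ i j x)

  τ^-comm : ∀ i j x → (τ^ i) ((τ^ j) x) ≡ (τ^ j) ((τ^ i) x)
  τ^-comm i j x = trans (sym (τ^-+ i j x)) (trans (cong (λ k → (τ^ k) x) (ℕ.+-comm i j)) (τ^-+ j i x))

  τ^-injective : ∀ i x y → (τ^ i) x ≡ (τ^ i) y → x ≡ y
  τ^-injective zero x y eq = eq
  τ^-injective (suc i) x y eq = τ^-injective i x y (τ-injective _ _ eq)

  τ^-periodic : ∀ q x → (τ^ (q * 4)) x ≡ x
  τ^-periodic zero x = refl
  τ^-periodic (suc q) x = trans (τ⁴≡id _) (τ^-periodic q x)

  τ^-inverse : ∀ i x → (τ^ i) ((τ^ (i * 3)) x) ≡ x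
  τ^-inverse i x = trans (sym (τ^-+ i (i * 3) x))
    (trans (cong (λ k → (τ^ k) x) (sym (ℕ.*-suc i 3))) (τ^-periodic i x))

  Affine : (G n → G n) → Set
  Affine f = Σ ℕ λ i → Σ (G n) λ c → ∀ x → f x ≡ (τ^ i) x + c

  affine-isPerm : ∀ {f} → Affine f → IsPerm f
  affine-isPerm {f} (i , c , f≡) = injective , surjective
    where
    injective : ∀ x y → f x ≡ f y → x ≡ y
    injective x y eq = τ^-injective i x y (+-cancelʳ c (trans (sym (f≡ x)) (trans eq (f≡ y))))
    surjective : ∀ y → ∃[ x ] f x ≡ y
    surjective y = (τ^ (i * 3)) (y + - c) ,
      trans (f≡ _) (trans (cong (_+ c) (τ^-inverse i (y + - c))) (x-y+y≡x y c))

  affine-difference : ∀ {f} → (af : Affine f) → ∀ x y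
                    → f y + negG e (f x) ≡ (τ^ proj₁ af) (y + negG e x)
  affine-difference {f} (i , c , f≡) x y = begin
    f y + negG e (f x)                    ≡⟨ cong₂ (λ u w → u + negG e w) (f≡ y) (f≡ x) ⟩
    (τ^ i) y + c + negG e ((τ^ i) x + c)  ≡⟨ cong ((τ^ i) y + c +_) (negG≡- _) ⟩
    (τ^ i) y + c + - ((τ^ i) x + c)       ≡⟨ solve 3 (λ X Y C → Y ⊞ C ⊞ ((X ⊞ C) ⊞ (X ⊞ C) ⊞ (X ⊞ C))
                                                ⊜ Y ⊞ (X ⊞ X ⊞ X) ⊞ (C ⊞ C ⊞ C) ⊞ C) refl ((τ^ i) x) ((τ^ i) y) c ⟩
    (τ^ i) y + - (τ^ i) x + - c + c       ≡⟨ x-y+y≡x _ c ⟩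
    (τ^ i) y + - (τ^ i) x                 ≡⟨ sym (trans (τ^-hom i y (- x)) (cong ((τ^ i) y +_) (τ^-neg i x))) ⟩
    (τ^ i) (y + - x)                      ≡⟨ cong ((τ^ i) ∘ (y +_)) (sym (negG≡- x)) ⟩
    (τ^ i) (y + negG e x)                 ∎
    where open ≡-Reasoning

  affine-isSchemeAut : ∀ k (D : ℕ → G n → Set) → (∀ j i x → D j x → D j ((τ^ i) x))
                     → ∀ {f} → Affine f → IsSchemeAut e k D f
  affine-isSchemeAut k D D-τ^ {f} af@(i , _ , _) = affine-isPerm af , λ j _ g₁ g₂ →
    (λ Dd → subst (D j) (sym (affine-difference af g₁ g₂)) (D-τ^ j i _ Dd)) ,
    (λ Dfd → subst (D j) (τ^-inverseˡ (g₂ + negG e g₁))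
               (D-τ^ j (i * 3) _ (subst (D j) (affine-difference af g₁ g₂) Dfd)))
    where
    τ^-inverseˡ : ∀ x → (τ^ (i * 3)) ((τ^ i) x) ≡ x
    τ^-inverseˡ x = trans (τ^-comm (i * 3) i x) (τ^-inverse i x)

  τ^x≡0ᴳ⇒x≡0ᴳ : ∀ i {x} → (τ^ i) x ≡ 0ᴳ → x ≡ 0ᴳ
  τ^x≡0ᴳ⇒x≡0ᴳ i {x} eq = τ^-injective i x 0ᴳ (trans eq (sym (τ^-0ᴳ i)))

  frob-involutive : ∀ x → frob (frob x) ≡ x
  frob-involutive 𝟎 = refl
  frob-involutive 𝟏 = refl
  frob-involutive ω = refl
  frob-involutive ω+1 = refl

  module _ (a : Vec F4 n) where

    Q-τ^ : IsIsometry a τ → ∀ i x → Q a ((τ^ i) x) ≡ Q a x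
    Q-τ^ iso zero x = refl
    Q-τ^ iso (suc i) x = trans (iso _) (Q-τ^ iso i x)

    Q-τ^-Galois : IsGenIsometry a τ → ∀ i x
                → Q a ((τ^ i) x) ≡ Q a x ⊎ Q a ((τ^ i) x) ≡ frob (Q a x)
    Q-τ^-Galois (inj₁ iso) i x = inj₁ (Q-τ^ iso i x)
    Q-τ^-Galois (inj₂ frob-iso) zero x = inj₁ refl
    Q-τ^-Galois (inj₂ frob-iso) (suc i) x with Q-τ^-Galois (inj₂ frob-iso) i x
    ... | inj₁ eq = inj₂ (trans (frob-iso _) (cong frob eq))
    ... | inj₂ eq = inj₁ (trans (frob-iso _) (trans (cong frob eq) (frob-involutive _)))

    D3-Galois-invariant : ∀ j {x y} → Q a y ≡ Q a x ⊎ Q a y ≡ frob (Q a x)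
                        → (y ≡ 0ᴳ → x ≡ 0ᴳ) → D3 a j x → D3 a j y
    D3-Galois-invariant zero (inj₁ eq) y≡0⇒x≡0 (q , x≢0) = trans eq q , x≢0 ∘ y≡0⇒x≡0
    D3-Galois-invariant zero (inj₂ eq) y≡0⇒x≡0 (q , x≢0) = trans eq (cong frob q) , x≢0 ∘ y≡0⇒x≡0
    D3-Galois-invariant (suc zero) (inj₁ eq) _ q = trans eq q
    D3-Galois-invariant (suc zero) (inj₂ eq) _ q = trans eq (cong frob q)
    D3-Galois-invariant (suc (suc j)) (inj₁ eq) _ (inj₁ q) = inj₁ (trans eq q)
    D3-Galois-invariant (suc (suc j)) (inj₁ eq) _ (inj₂ q) = inj₂ (trans eq q)
    D3-Galois-invariant (suc (suc j)) (inj₂ eq) _ (inj₁ q) = inj₂ (trans eq (cong frob q))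
    D3-Galois-invariant (suc (suc j)) (inj₂ eq) _ (inj₂ q) = inj₁ (trans eq (cong frob q))

    D4-invariant : ∀ j {x y} → Q a y ≡ Q a x → (y ≡ 0ᴳ → x ≡ 0ᴳ) → D4 a j x → D4 a j y
    D4-invariant zero eq y≡0⇒x≡0 (q , x≢0) = trans eq q , x≢0 ∘ y≡0⇒x≡0
    D4-invariant (suc zero) eq _ q = trans eq q
    D4-invariant (suc (suc zero)) eq _ q = trans eq q
    D4-invariant (suc (suc (suc j))) eq _ q = trans eq q

    affine-isSchemeAut₃ : IsGenIsometry a τ → ∀ {f} → Affine f → IsSchemeAut e 3 (D3 a) f
    affine-isSchemeAut₃ gi = affine-isSchemeAut 3 (D3 a)
      (λ j i x → D3-Galois-invariant j (Q-τ^-Galois gi i x) (τ^x≡0ᴳ⇒x≡0ᴳ i))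

    affine-isSchemeAut₄ : IsIsometry a τ → ∀ {f} → Affine f → IsSchemeAut e 4 (D4 a) f
    affine-isSchemeAut₄ iso = affine-isSchemeAut 4 (D4 a)
      (λ j i x → D4-invariant j (Q-τ^ iso i x) (τ^x≡0ᴳ⇒x≡0ᴳ i))

  Δ : G n → G n
  Δ x = τ x + - x

  Δ^_ : ℕ → G n → G n
  Δ^_ = τpow Δ

  Δ-hom : ∀ x y → Δ (x + y) ≡ Δ x + Δ y
  Δ-hom x y = trans (cong (_+ - (x + y)) (τ-hom x y))
    (solve 4 (λ X Y x y → X ⊞ Y ⊞ ((x ⊞ y) ⊞ (x ⊞ y) ⊞ (x ⊞ y)) ⊜ X ⊞ (x ⊞ x ⊞ x) ⊞ (Y ⊞ (y ⊞ y ⊞ y)))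
      refl (τ x) (τ y) x y)

  Δ^-hom : ∀ j x y → (Δ^ j) (x + y) ≡ (Δ^ j) x + (Δ^ j) y
  Δ^-hom zero x y = refl
  Δ^-hom (suc j) x y = trans (cong Δ (Δ^-hom j x y)) (Δ-hom _ _)

  Δ^-0ᴳ : ∀ j → (Δ^ j) 0ᴳ ≡ 0ᴳ
  Δ^-0ᴳ zero = refl
  Δ^-0ᴳ (suc j) = trans (cong Δ (Δ^-0ᴳ j)) (trans (cong (_+ - 0ᴳ) τ-0ᴳ) (+-inverseʳ 0ᴳ))

  τ^-Δ^ : ∀ i j x → (τ^ i) ((Δ^ j) x) ≡ (Δ^ j) ((τ^ i) x)
  τ^-Δ^ i zero x = refl
  τ^-Δ^ i (suc j) x = trans (τ^-Δ i _) (cong Δ (τ^-Δ^ i j x))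
    where
    τ^-Δ : ∀ i x → (τ^ i) (Δ x) ≡ Δ ((τ^ i) x)
    τ^-Δ i x = trans (τ^-hom i (τ x) (- x)) (cong₂ _+_ (τ^-comm i 1 x) (τ^-neg i x))

  ImΔ^ : ℕ → G n → Set
  ImΔ^ j m = ∃[ y ] m ≡ (Δ^ j) y

  ImΔ^-0ᴳ : ∀ j → ImΔ^ j 0ᴳ
  ImΔ^-0ᴳ j = 0ᴳ , sym (Δ^-0ᴳ j)

  ImΔ^-+ : ∀ j {m m′} → ImΔ^ j m → ImΔ^ j m′ → ImΔ^ j (m + m′)
  ImΔ^-+ j (y , refl) (y′ , refl) = y + y′ , sym (Δ^-hom j y y′)

  ImΔ^-neg : ∀ j {m} → ImΔ^ j m → ImΔ^ j (- m)
  ImΔ^-neg j Im = ImΔ^-+ j (ImΔ^-+ j Im Im) Im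

  ImΔ^-τ^ : ∀ j i {m} → ImΔ^ j m → ImΔ^ j ((τ^ i) m)
  ImΔ^-τ^ j i (y , refl) = (τ^ i) y , τ^-Δ^ i j y

  twist : ℕ → G n → G n
  twist k m = (τ^ k) m + - m

  -- τᵏ − 1 = Δ (1 + τ + ⋯ + τᵏ⁻¹)
  ImΔ^-twist : ∀ j k {m} → ImΔ^ j m → ImΔ^ (suc j) (twist k m)
  ImΔ^-twist j zero {m} Im = subst (ImΔ^ (suc j)) (sym (+-inverseʳ m)) (ImΔ^-0ᴳ (suc j))
  ImΔ^-twist j (suc k) {m} Im@(y , refl) =
    subst (ImΔ^ (suc j)) telescope (ImΔ^-+ (suc j) ((τ^ k) y , cong Δ (τ^-Δ^ k j y)) (ImΔ^-twist j k Im))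
    where
    telescope : Δ ((τ^ k) m) + twist k m ≡ twist (suc k) m
    telescope = trans
      (solve 3 (λ X M Y → X ⊞ (Y ⊞ Y ⊞ Y) ⊞ (Y ⊞ (M ⊞ M ⊞ M)) ⊜ X ⊞ (M ⊞ M ⊞ M) ⊞ (Y ⊞ Y ⊞ Y) ⊞ Y)
        refl (τ ((τ^ k) m)) m ((τ^ k) m))
      (x-y+y≡x _ ((τ^ k) m))

  infixr 7 _·_
  _·_ : ℕ → G n → G n
  zero · x = 0ᴳ
  suc k · x = x + k · x

  ·-distribʳ : ∀ k l x → (k +ℕ l) · x ≡ k · x + l · x
  ·-distribʳ zero l x = sym (+-identityˡ _)
  ·-distribʳ (suc k) l x = trans (cong (x +_) (·-distribʳ k l x)) (sym (+-assoc x _ _))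

  τ-· : ∀ k x → τ (k · x) ≡ k · τ x
  τ-· zero x = τ-0ᴳ
  τ-· (suc k) x = trans (τ-hom _ _) (cong (τ x +_) (τ-· k x))

  4∣⇒·≡0ᴳ : ∀ {k} x → 4 ∣ k → k · x ≡ 0ᴳ
  4∣⇒·≡0ᴳ x (divides zero refl) = refl
  4∣⇒·≡0ᴳ x (divides (suc q) refl) =
    trans (·-distribʳ 4 (q * 4) x) (trans (cong₂ _+_ 4·x≡0ᴳ (4∣⇒·≡0ᴳ x (divides q refl))) (+-identityʳ 0ᴳ))
    where
    4·x≡0ᴳ : 4 · x ≡ 0ᴳ
    4·x≡0ᴳ = trans (solve 1 (λ x → x ⊞ (x ⊞ (x ⊞ (x ⊞ Expr.id))) ⊜ x ⊞ (x ⊞ x ⊞ x)) refl x) (+-inverseʳ x)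

  Coefficients : Set
  Coefficients = ℕ × ℕ × ℕ × ℕ

  ⟦_⟧ : Coefficients → G n → G n
  ⟦ c₀ , c₁ , c₂ , c₃ ⟧ y = c₀ · y + c₁ · τ y + c₂ · τ (τ y) + c₃ · τ (τ (τ y))

  -- multiplication by τ + 3 = τ − 1 in ℕ[τ]/(τ⁴ − 1)
  Δ-coefficients : Coefficients → Coefficients
  Δ-coefficients (c₀ , c₁ , c₂ , c₃) =
    c₃ +ℕ c₀ +ℕ c₀ +ℕ c₀ , c₀ +ℕ c₁ +ℕ c₁ +ℕ c₁ , c₁ +ℕ c₂ +ℕ c₂ +ℕ c₂ , c₂ +ℕ c₃ +ℕ c₃ +ℕ c₃

  Δ-⟦⟧ : ∀ c y → Δ (⟦ c ⟧ y) ≡ ⟦ Δ-coefficients c ⟧ y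
  Δ-⟦⟧ c@(c₀ , c₁ , c₂ , c₃) y = begin
    τ (⟦ c ⟧ y) + - ⟦ c ⟧ y
      ≡⟨ cong (_+ - ⟦ c ⟧ y) τ-⟦⟧ ⟩
    c₀ · y₁ + c₁ · y₂ + c₂ · y₃ + c₃ · y₀ + - ⟦ c ⟧ y
      ≡⟨ solve 8 (λ a₀ a₁ a₂ a₃ b₀ b₁ b₂ b₃ →
           b₀ ⊞ b₁ ⊞ b₂ ⊞ b₃ ⊞ ((a₀ ⊞ a₁ ⊞ a₂ ⊞ a₃) ⊞ (a₀ ⊞ a₁ ⊞ a₂ ⊞ a₃) ⊞ (a₀ ⊞ a₁ ⊞ a₂ ⊞ a₃))
           ⊜ (b₃ ⊞ a₀ ⊞ a₀ ⊞ a₀) ⊞ (b₀ ⊞ a₁ ⊞ a₁ ⊞ a₁) ⊞ (b₁ ⊞ a₂ ⊞ a₂ ⊞ a₂) ⊞ (b₂ ⊞ a₃ ⊞ a₃ ⊞ a₃))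
         refl (c₀ · y₀) (c₁ · y₁) (c₂ · y₂) (c₃ · y₃) (c₀ · y₁) (c₁ · y₂) (c₂ · y₃) (c₃ · y₀) ⟩
    (c₃ · y₀ + c₀ · y₀ + c₀ · y₀ + c₀ · y₀) + (c₀ · y₁ + c₁ · y₁ + c₁ · y₁ + c₁ · y₁)
      + (c₁ · y₂ + c₂ · y₂ + c₂ · y₂ + c₂ · y₂) + (c₂ · y₃ + c₃ · y₃ + c₃ · y₃ + c₃ · y₃)
      ≡⟨ sym (cong₂ _+_ (cong₂ _+_ (cong₂ _+_ (·-distribʳ³ c₃ c₀ y₀) (·-distribʳ³ c₀ c₁ y₁))
                                    (·-distribʳ³ c₁ c₂ y₂))
                         (·-distribʳ³ c₂ c₃ y₃)) ⟩
    ⟦ Δ-coefficients c ⟧ y ∎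
    where
    open ≡-Reasoning
    y₀ y₁ y₂ y₃ : G n
    y₀ = y
    y₁ = τ y
    y₂ = τ (τ y)
    y₃ = τ (τ (τ y))
    τ-⟦⟧ : τ (⟦ c ⟧ y) ≡ c₀ · y₁ + c₁ · y₂ + c₂ · y₃ + c₃ · y₀
    τ-⟦⟧ = trans (τ-hom _ _) (cong₂ _+_
      (trans (τ-hom _ _) (cong₂ _+_ (trans (τ-hom _ _) (cong₂ _+_ (τ-· c₀ _) (τ-· c₁ _))) (τ-· c₂ _)))
      (trans (τ-· c₃ _) (cong (c₃ ·_) (τ⁴≡id y))))
    ·-distribʳ³ : ∀ a b x → (a +ℕ b +ℕ b +ℕ b) · x ≡ a · x + b · x + b · x + b · x
    ·-distribʳ³ a b x = trans (·-distribʳ (a +ℕ b +ℕ b) b x)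
      (cong (_+ b · x) (trans (·-distribʳ (a +ℕ b) b x) (cong (_+ b · x) (·-distribʳ a b x))))

  Δ^-⟦⟧ : ∀ j y → (Δ^ j) y ≡ ⟦ fold (1 , 0 , 0 , 0) Δ-coefficients j ⟧ y
  Δ^-⟦⟧ zero y = sym (trans (+-identityʳ _) (trans (+-identityʳ _) (trans (+-identityʳ _) (+-identityʳ y))))
  Δ^-⟦⟧ (suc j) y = trans (cong Δ (Δ^-⟦⟧ j y)) (Δ-⟦⟧ (fold (1 , 0 , 0 , 0) Δ-coefficients j) y)

  -- (τ − 1)⁶ reduces to 864 + 1476τ + 1216τ² + 540τ³, whose coefficients are all divisible by 4.
  Δ^6≡0ᴳ : ∀ y → (Δ^ 6) y ≡ 0ᴳ
  Δ^6≡0ᴳ y = trans (Δ^-⟦⟧ 6 y) (trans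
    (cong₂ _+_ (cong₂ _+_ (cong₂ _+_ (4∣⇒·≡0ᴳ _ (divides 216 refl)) (4∣⇒·≡0ᴳ _ (divides 369 refl)))
                          (4∣⇒·≡0ᴳ _ (divides 304 refl)))
               (4∣⇒·≡0ᴳ _ (divides 135 refl)))
    (trans (+-identityʳ _) (trans (+-identityʳ _) (+-identityʳ 0ᴳ))))

  Translation : ℕ → (G n → G n) → Set
  Translation j f = Σ (G n) λ m → ImΔ^ j m × (∀ z → f z ≡ z + m)

  Gen-translation : ∀ j {S : (G n → G n) → Set} → (∀ {f} → S f → Translation j f)
                  → ∀ {f} → Gen S f → Translation j f
  Gen-translation j S⊆T (gen s) = S⊆T s
  Gen-translation j S⊆T unit = 0ᴳ , ImΔ^-0ᴳ j , λ z → sym (+-identityʳ z)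
  Gen-translation j S⊆T (comp {f} {f′} p q) with Gen-translation j S⊆T p | Gen-translation j S⊆T q
  ... | m , Im , f≡ | m′ , Im′ , f′≡ =
    m′ + m , ImΔ^-+ j Im′ Im , λ z → trans (f≡ (f′ z)) (trans (cong (_+ m) (f′≡ z)) (+-assoc z m′ m))
  Gen-translation j S⊆T (inv {f} {f′} p (_ , f∘f′≡id)) with Gen-translation j S⊆T p
  ... | m , Im , f≡ =
    - m , ImΔ^-neg j Im , λ z → trans (sym (x+y-y≡x (f′ z) m)) (cong (_+ - m) (trans (sym (f≡ (f′ z))) (f∘f′≡id z)))
  Gen-translation j S⊆T (ext p f≗g) with Gen-translation j S⊆T p
  ... | m , Im , f≡ = m , Im , λ z → trans (sym (f≗g z)) (f≡ z)

  commutator-affine : ∀ {x x′ y y′} α β c d → (∀ z → x z ≡ (τ^ α) z + c) → (∀ z → y z ≡ (τ^ β) z + d)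
    → IsInverse x x′ → IsInverse y y′
    → ∀ z → x′ (y′ (x (y z))) ≡ z + (τ^ ((α +ℕ β) * 3)) (twist α d + - twist β c)
  commutator-affine {x} {x′} {y} {y′} α β c d x≡ y≡ (x′∘x≡id , _) (y′∘y≡id , _) z =
    trans (cong (x′ ∘ y′) x∘y≡y∘x∘R-w) (trans (cong x′ (y′∘y≡id _)) (x′∘x≡id _))
    where
    open ≡-Reasoning
    u : G n
    u = twist α d + - twist β c
    w : G n
    w = (τ^ ((α +ℕ β) * 3)) u
    τ^β∘τ^α-w : (τ^ β) ((τ^ α) w) ≡ u
    τ^β∘τ^α-w = trans (τ^-comm β α w) (trans (sym (τ^-+ α β w)) (τ^-inverse (α +ℕ β) u))
    τ^βαz : G n
    τ^βαz = (τ^ β) ((τ^ α) z)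
    cancel : τ^βαz + u + (τ^ β) c + d ≡ τ^βαz + (τ^ α) d + c
    cancel = trans
      (solve 5 (λ A P c d Q → A ⊞ ((P ⊞ (d ⊞ d ⊞ d)) ⊞ ((Q ⊞ (c ⊞ c ⊞ c)) ⊞ (Q ⊞ (c ⊞ c ⊞ c)) ⊞ (Q ⊞ (c ⊞ c ⊞ c)))) ⊞ Q ⊞ d
                  ⊜ A ⊞ P ⊞ c ⊞ ((d ⊞ Q ⊞ c ⊞ c) ⊞ (d ⊞ Q ⊞ c ⊞ c) ⊞ (d ⊞ Q ⊞ c ⊞ c) ⊞ (d ⊞ Q ⊞ c ⊞ c)))
        refl τ^βαz ((τ^ α) d) c d ((τ^ β) c))
      (x+4y≡x _ (d + (τ^ β) c + c + c))
    x∘y≡y∘x∘R-w : x (y z) ≡ y (x (z + w))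
    x∘y≡y∘x∘R-w = begin
      x (y z)                                      ≡⟨ x≡ (y z) ⟩
      (τ^ α) (y z) + c                             ≡⟨ cong (λ q → (τ^ α) q + c) (y≡ z) ⟩
      (τ^ α) ((τ^ β) z + d) + c                    ≡⟨ cong (_+ c) (τ^-hom α _ _) ⟩
      (τ^ α) ((τ^ β) z) + (τ^ α) d + c             ≡⟨ cong (λ q → q + (τ^ α) d + c) (τ^-comm α β z) ⟩
      τ^βαz + (τ^ α) d + c                         ≡⟨ sym cancel ⟩
      τ^βαz + u + (τ^ β) c + d                     ≡⟨ cong (λ q → τ^βαz + q + (τ^ β) c + d) (sym τ^β∘τ^α-w) ⟩
      τ^βαz + (τ^ β) ((τ^ α) w) + (τ^ β) c + d     ≡⟨ cong (_+ d) (sym (trans (τ^-hom β _ _) (cong (_+ (τ^ β) c) (τ^-hom β _ _)))) ⟩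
      (τ^ β) ((τ^ α) z + (τ^ α) w + c) + d         ≡⟨ cong (λ q → (τ^ β) (q + c) + d) (sym (τ^-hom α z w)) ⟩
      (τ^ β) ((τ^ α) (z + w) + c) + d              ≡⟨ cong (λ q → (τ^ β) q + d) (sym (x≡ _)) ⟩
      (τ^ β) (x (z + w)) + d                       ≡⟨ sym (y≡ _) ⟩
      y (x (z + w))                                ∎

  commutator-translation : ∀ j {f x x′ y y′} α β c d → (∀ z → x z ≡ (τ^ α) z + c) → (∀ z → y z ≡ (τ^ β) z + d)
    → IsInverse x x′ → IsInverse y y′ → ImΔ^ (suc j) (twist α d) → ImΔ^ (suc j) (twist β c)
    → (∀ z → f z ≡ x′ (y′ (x (y z)))) → Translation (suc j) f
  commutator-translation j α β c d x≡ y≡ x-inv y-inv Im-d Im-c f≡ =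
    _ , ImΔ^-τ^ (suc j) ((α +ℕ β) * 3) (ImΔ^-+ (suc j) Im-d (ImΔ^-neg (suc j) Im-c)) ,
    λ z → trans (f≡ z) (commutator-affine α β c d x≡ y≡ x-inv y-inv z)

  lcs-translation : ∀ {H} → (∀ {f} → H f → Affine f) → ∀ j {f} → lcs H (suc j) f → Translation (suc j) f
  lcs-translation H-affine zero = Gen-translation 1 λ where
    (x , y , x′ , y′ , Hx , Hy , x-inv , y-inv , f≡) →
      let (α , c , x≡) = H-affine Hx ; (β , d , y≡) = H-affine Hy in
      commutator-translation 0 α β c d x≡ y≡ x-inv y-inv (ImΔ^-twist 0 α (d , refl)) (ImΔ^-twist 0 β (c , refl)) f≡
  lcs-translation H-affine (suc j) = Gen-translation (suc (suc j)) λ where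
    (x , y , x′ , y′ , γx , Hy , x-inv , y-inv , f≡) →
      let (m , Im-m , x≡) = lcs-translation H-affine j γx ; (β , d , y≡) = H-affine Hy in
      commutator-translation (suc j) 0 β m d x≡ y≡ x-inv y-inv
        (subst (ImΔ^ (suc (suc j))) (sym (+-inverseʳ d)) (ImΔ^-0ᴳ (suc (suc j))))
        (ImΔ^-twist (suc j) β Im-m) f≡

  affine-nilpotent : ∀ {H} → (∀ {f} → H f → Affine f) → NilClassAtMost 6 H
  affine-nilpotent H-affine f γ₇f z with lcs-translation H-affine 5 γ₇f
  ... | m , (y , refl) , f≡ = trans (f≡ z) (trans (cong (z +_) (Δ^6≡0ᴳ y)) (+-identityʳ z))

  open Characters e

  InΦIm? : ∀ x → Dec (InΦIm e τ x)
  InΦIm? x = ∃-dec (∈-allG n) λ u → ∃-dec (∈-allG n) λ v → x ≟G (u + u + (v + τ (τ v)))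

  InΦIm-+ : ∀ {x y} → InΦIm e τ x → InΦIm e τ y → InΦIm e τ (x + y)
  InΦIm-+ (u , v , refl) (u′ , v′ , refl) = u + u′ , v + v′ , (begin
    u + u + (v + τ (τ v)) + (u′ + u′ + (v′ + τ (τ v′)))
      ≡⟨ solve 6 (λ u v w u′ v′ w′ → u ⊞ u ⊞ (v ⊞ w) ⊞ (u′ ⊞ u′ ⊞ (v′ ⊞ w′))
                                   ⊜ u ⊞ u′ ⊞ (u ⊞ u′) ⊞ (v ⊞ v′ ⊞ (w ⊞ w′))) refl u v (τ (τ v)) u′ v′ (τ (τ v′)) ⟩
    u + u′ + (u + u′) + (v + v′ + (τ (τ v) + τ (τ v′)))
      ≡⟨ cong (λ w → u + u′ + (u + u′) + (v + v′ + w)) (sym (τ^-hom 2 v v′)) ⟩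
    u + u′ + (u + u′) + (v + v′ + τ (τ (v + v′))) ∎)
    where open ≡-Reasoning

  InΦIm-double : ∀ x → InΦIm e τ (x + x)
  InΦIm-double x = x , 0ᴳ , sym (trans (cong (x + x +_) (trans (cong (0ᴳ +_) (τ^-0ᴳ 2)) (+-identityˡ 0ᴳ))) (+-identityʳ _))

  InΦIm-τ² : ∀ x → InΦIm e τ (x + τ (τ x))
  InΦIm-τ² x = 0ᴳ , x , sym (trans (cong (_+ (x + τ (τ x))) (+-identityˡ 0ᴳ)) (+-identityˡ _))

  τ²-invariant-separatingCharacter : ∀ {v} → ¬ InΦIm e τ v → Σ (G n → Bool) λ χ →
    IsCharacter χ × χ v ≡ true × (∀ x → χ (τ (τ x)) ≡ χ x)
  τ²-invariant-separatingCharacter {v} v∉W =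
    let (χ , χ-hom , χv≡true , χ-W) = separatingCharacter W-avoiding in
    χ , χ-hom , χv≡true ,
    λ x → sym (xor≡false⇒≡ (trans (sym (χ-hom x _)) (χ-W _ (inW (InΦIm-τ² x)))))
    where
    inW : ∀ {x} → InΦIm e τ x → does (InΦIm? x) ≡ true
    inW {x} = dec-true (InΦIm? x)
    W-avoiding : AvoidingSubgroup v (does ∘ InΦIm?)
    W-avoiding = record
      { +-closed = λ x y Wx Wy → inW (InΦIm-+ (does≡true⇒ (InΦIm? x) Wx) (does≡true⇒ (InΦIm? y) Wy))
      ; doubles = λ x → inW (InΦIm-double x)
      ; avoids = dec-false (InΦIm? v) v∉W }

infixl 6 _⊻_
_⊻_ : Bool × Bool → Bool × Bool → Bool × Bool
(p , q) ⊻ (p′ , q′) = p xor p′ , q xor q′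

isZero : Bool × Bool → Bool
isZero (p , q) = not (p ∨ q)

isZero⇒≡0 : ∀ c → isZero c ≡ true → c ≡ (false , false)
isZero⇒≡0 (false , false) _ = refl

⊻-identityʳ : ∀ c → c ⊻ (false , false) ≡ c
⊻-identityʳ (p , q) = cong₂ _,_ (xor-identityʳ p) (xor-identityʳ q)

⊻-self : ∀ c → c ⊻ c ≡ (false , false)
⊻-self (p , q) = cong₂ _,_ (xor-same p) (xor-same q)

-- For a = χ(g): the values of (χ, χ ∘ τ) at τⁱ(g) and at hᵢ, both depending on i mod 4 only.
τgClass : Bool → ℕ → Bool × Bool
τgClass a 0 = a , not a
τgClass a 1 = not a , a
τgClass a (suc (suc i)) = τgClass a i

hClass : Bool → ℕ → Bool × Bool
hClass a 0 = false , false
hClass a 1 = a , not a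
hClass a 2 = true , true
hClass a 3 = not a , a
hClass a (suc (suc (suc (suc i)))) = hClass a i

hClass-suc : ∀ a i → hClass a (suc i) ≡ hClass a i ⊻ τgClass a i
hClass-suc a 0 = refl
hClass-suc true 1 = refl
hClass-suc false 1 = refl
hClass-suc true 2 = refl
hClass-suc false 2 = refl
hClass-suc true 3 = refl
hClass-suc false 3 = refl
hClass-suc a (suc (suc (suc (suc i)))) = hClass-suc a i

hClass-*4 : ∀ a q → hClass a (q * 4) ≡ (false , false)
hClass-*4 a zero = refl
hClass-*4 a (suc q) = hClass-*4 a q

hClass-nonzero : ∀ a → isZero (hClass a 1) ≡ false × isZero (hClass a 2) ≡ false × isZero (hClass a 3) ≡ false
hClass-nonzero true = refl , refl , refl
hClass-nonzero false = refl , refl , refl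

hClass-partition : ∀ a c → 𝟙 (isZero (c ⊻ hClass a 0)) +ℕ (𝟙 (isZero (c ⊻ hClass a 1))
                          +ℕ (𝟙 (isZero (c ⊻ hClass a 2)) +ℕ 𝟙 (isZero (c ⊻ hClass a 3)))) ≡ 1
hClass-partition true (true , true) = refl
hClass-partition true (true , false) = refl
hClass-partition true (false , true) = refl
hClass-partition true (false , false) = refl
hClass-partition false (true , true) = refl
hClass-partition false (true , false) = refl
hClass-partition false (false , true) = refl
hClass-partition false (false , false) = refl

rotation : Bool → Bool × Bool → ℕ
rotation a (false , false) = 0
rotation a (true , true) = 2
rotation a (p , _) = if p xor a then 3 else 1

hClass-rotation : ∀ a c → hClass a (rotation a c) ≡ c
hClass-rotation true (true , true) = refl
hClass-rotation true (true , false) = refl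
hClass-rotation true (false , true) = refl
hClass-rotation true (false , false) = refl
hClass-rotation false (true , true) = refl
hClass-rotation false (true , false) = refl
hClass-rotation false (false , true) = refl
hClass-rotation false (false , false) = refl

module Construction {n : ℕ} (e : Vec F2 n) (τ : G n → G n)
  (τ-hom : ∀ x y → τ (addG e x y) ≡ addG e (τ x) (τ y))
  (τ-injective : ∀ x y → τ x ≡ τ y → x ≡ y)
  (τ⁴≡id : ∀ x → τ (τ (τ (τ x))) ≡ x)
  (χ : G n → Bool) (χ-hom : Characters.IsCharacter e χ) (χ-τ² : ∀ x → χ (τ (τ x)) ≡ χ x)
  (g : G n) (χ-twist : χ (addG e (τ g) (negG e g)) ≡ true) where

  open Group e
  open Automorphism e τ τ-hom τ-injective τ⁴≡id
  open Characters e

  ψ : G n → Bool × Bool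
  ψ y = χ y , χ (τ y)

  ψ-hom : ∀ x y → ψ (x + y) ≡ ψ x ⊻ ψ y
  ψ-hom x y = cong₂ _,_ (χ-hom x y) (trans (cong χ (τ-hom x y)) (χ-hom (τ x) (τ y)))

  ψ-τ : ∀ y → ψ (τ y) ≡ swap (ψ y)
  ψ-τ y = cong (χ (τ y) ,_) (χ-τ² y)

  ψ-0ᴳ : ψ 0ᴳ ≡ (false , false)
  ψ-0ᴳ = cong₂ _,_ (χ-0ᴳ {χ} χ-hom) (trans (cong χ τ-0ᴳ) (χ-0ᴳ {χ} χ-hom))

  ψ-neg : ∀ y → ψ (- y) ≡ ψ y
  ψ-neg y = cong₂ _,_ (χ-neg {χ} χ-hom y) (trans (cong χ (τ-neg y)) (χ-neg {χ} χ-hom (τ y)))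

  K : G n → Bool
  K y = isZero (ψ y)

  K⇒ψ≡0 : ∀ {y} → K y ≡ true → ψ y ≡ (false , false)
  K⇒ψ≡0 {y} = isZero⇒≡0 (ψ y)

  ψ≡0⇒K : ∀ {y} → ψ y ≡ (false , false) → K y ≡ true
  ψ≡0⇒K = cong isZero

  ψ-+K : ∀ y {k} → K k ≡ true → ψ (y + k) ≡ ψ y
  ψ-+K y {k} Kk = trans (ψ-hom y k) (trans (cong (ψ y ⊻_) (K⇒ψ≡0 Kk)) (⊻-identityʳ (ψ y)))

  K-0ᴳ : K 0ᴳ ≡ true
  K-0ᴳ = ψ≡0⇒K ψ-0ᴳ

  K-+ : ∀ {x y} → K x ≡ true → K y ≡ true → K (x + y) ≡ true
  K-+ {x} Kx Ky = ψ≡0⇒K (trans (ψ-+K x Ky) (K⇒ψ≡0 Kx))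

  K-neg : ∀ {y} → K y ≡ true → K (- y) ≡ true
  K-neg {y} Ky = ψ≡0⇒K (trans (ψ-neg y) (K⇒ψ≡0 Ky))

  K-isSubgroup : IsSubgroup e K
  K-isSubgroup = K-0ᴳ , (λ _ _ → K-+) , λ x Kx → subst (λ z → K z ≡ true) (sym (negG≡- x)) (K-neg Kx)

  K-invariant : IsInvariant τ K
  K-invariant y Ky = ψ≡0⇒K (trans (ψ-τ y) (cong swap (K⇒ψ≡0 Ky)))

  K-τ^ : ∀ i {y} → K y ≡ true → K ((τ^ i) y) ≡ true
  K-τ^ zero Ky = Ky
  K-τ^ (suc i) Ky = K-invariant _ (K-τ^ i Ky)

  χg : Bool
  χg = χ g

  ψ-τ^g : ∀ i → ψ ((τ^ i) g) ≡ τgClass χg i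
  ψ-τ^g 0 = cong (χg ,_) (xor≡true⇒≡not (trans (cong (χ (τ g) xor_) χ-negg) χ-τg-g))
    where
    χ-negg : χg ≡ χ (negG e g)
    χ-negg = sym (trans (cong χ (negG≡- g)) (χ-neg {χ} χ-hom g))
    χ-τg-g : χ (τ g) xor χ (negG e g) ≡ true
    χ-τg-g = trans (sym (χ-hom (τ g) (negG e g))) χ-twist
  ψ-τ^g 1 = trans (ψ-τ g) (cong swap (ψ-τ^g 0))
  ψ-τ^g (suc (suc i)) = trans (cong₂ _,_ (χ-τ² _) (χ-τ² _)) (ψ-τ^g i)

  h : ℕ → G n
  h = hSeq e τ g

  ψ-h : ∀ i → ψ (h i) ≡ hClass χg i
  ψ-h zero = ψ-0ᴳ
  ψ-h (suc i) = begin
    ψ (h i + (τ^ i) g)           ≡⟨ ψ-hom (h i) ((τ^ i) g) ⟩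
    ψ (h i) ⊻ ψ ((τ^ i) g)       ≡⟨ cong₂ _⊻_ (ψ-h i) (ψ-τ^g i) ⟩
    hClass χg i ⊻ τgClass χg i   ≡⟨ sym (hClass-suc χg i) ⟩
    hClass χg (suc i)            ∎
    where open ≡-Reasoning

  K-h-*4 : ∀ q → K (h (q * 4)) ≡ true
  K-h-*4 q = ψ≡0⇒K (trans (ψ-h (q * 4)) (hClass-*4 χg q))

  K-h₄ : K (h 4) ≡ true
  K-h₄ = K-h-*4 1

  K-h₁ : ¬ K (h 1) ≡ true
  K-h₁ K₁ = true≢false (trans (sym K₁) (trans (cong isZero (ψ-h 1)) (proj₁ (hClass-nonzero χg))))

  K-h₂ : ¬ K (h 2) ≡ true
  K-h₂ K₂ = true≢false (trans (sym K₂) (trans (cong isZero (ψ-h 2)) (proj₁ (proj₂ (hClass-nonzero χg)))))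

  K-h₃ : ¬ K (h 3) ≡ true
  K-h₃ K₃ = true≢false (trans (sym K₃) (trans (cong isZero (ψ-h 3)) (proj₂ (proj₂ (hClass-nonzero χg)))))

  -- G_𝐞 is the disjoint union of the cosets K + hᵣ, r < 4, all of size |K|.
  K-index4 : HasIndex4 n K
  K-index4 = begin
    length L                                        ≡⟨ length≡∑1 L ⟩
    ∑ L (λ _ → 1)                                   ≡⟨ ∑-cong L (λ y → sym (cosets y)) ⟩
    ∑ L (λ y → [K+h 0 ] y +ℕ ([K+h 1 ] y +ℕ ([K+h 2 ] y +ℕ [K+h 3 ] y)))
      ≡⟨ trans (∑-+ L _ _) (cong (∑ L [K+h 0 ] +ℕ_) (trans (∑-+ L _ _) (cong (∑ L [K+h 1 ] +ℕ_) (∑-+ L _ _)))) ⟩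
    ∑ L [K+h 0 ] +ℕ (∑ L [K+h 1 ] +ℕ (∑ L [K+h 2 ] +ℕ ∑ L [K+h 3 ]))
      ≡⟨ cong₂ _+ℕ_ (translate 0) (cong₂ _+ℕ_ (translate 1) (cong₂ _+ℕ_ (translate 2) (translate 3))) ⟩
    |K| +ℕ (|K| +ℕ (|K| +ℕ |K|))                   ≡⟨ cong (λ m → |K| +ℕ (|K| +ℕ (|K| +ℕ m))) (sym (ℕ.+-identityʳ |K|)) ⟩
    4 * |K|                                         ≡⟨ cong (4 *_) (sym (length-filterᵇ K L)) ⟩
    4 * length (filterᵇ K L)                        ∎
    where
    open ≡-Reasoning
    L : List (G n)
    L = allG n
    |K| : ℕ
    |K| = ∑ L (𝟙 ∘ K)
    [K+h_] : ℕ → G n → ℕ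
    [K+h r ] y = 𝟙 (K (y + h r))
    K+h≡ : ∀ r y → K (y + h r) ≡ isZero (ψ y ⊻ hClass χg r)
    K+h≡ r y = cong isZero (trans (ψ-hom y (h r)) (cong (ψ y ⊻_) (ψ-h r)))
    cosets : ∀ y → [K+h 0 ] y +ℕ ([K+h 1 ] y +ℕ ([K+h 2 ] y +ℕ [K+h 3 ] y)) ≡ 1
    cosets y rewrite K+h≡ 0 y | K+h≡ 1 y | K+h≡ 2 y | K+h≡ 3 y = hClass-partition χg (ψ y)
    translate : ∀ r → ∑ L [K+h r ] ≡ |K|
    translate r = ∑-allG-reindex n (_+ h r) (_+ - h r)
      (λ y → x+y-y≡x y (h r)) (λ y → x-y+y≡x y (h r)) (𝟙 ∘ K)

  h-suc : ∀ i → h (suc i) ≡ g + τ (h i)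
  h-suc zero = trans (+-identityˡ g) (sym (trans (cong (g +_) τ-0ᴳ) (+-identityʳ g)))
  h-suc (suc i) = begin
    h (suc i) + τ ((τ^ i) g)        ≡⟨ cong (_+ τ ((τ^ i) g)) (h-suc i) ⟩
    g + τ (h i) + τ ((τ^ i) g)      ≡⟨ +-assoc g _ _ ⟩
    g + (τ (h i) + τ ((τ^ i) g))    ≡⟨ cong (g +_) (sym (τ-hom _ _)) ⟩
    g + τ (h (suc i))               ∎
    where open ≡-Reasoning

  h-+ : ∀ i j → h (i +ℕ j) ≡ h i + (τ^ i) (h j)
  h-+ zero j = sym (+-identityˡ _)
  h-+ (suc i) j = begin
    h (suc (i +ℕ j))                    ≡⟨ h-suc (i +ℕ j) ⟩
    g + τ (h (i +ℕ j))                  ≡⟨ cong (λ z → g + τ z) (h-+ i j) ⟩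
    g + τ (h i + (τ^ i) (h j))          ≡⟨ cong (g +_) (τ-hom _ _) ⟩
    g + (τ (h i) + (τ^ suc i) (h j))    ≡⟨ sym (+-assoc g _ _) ⟩
    g + τ (h i) + (τ^ suc i) (h j)      ≡⟨ cong (_+ (τ^ suc i) (h j)) (sym (h-suc i)) ⟩
    h (suc i) + (τ^ suc i) (h j)        ∎
    where open ≡-Reasoning

  AffineK : (G n → G n) → Set
  AffineK f = Σ ℕ λ i → Σ (G n) λ k → K k ≡ true × (∀ x → f x ≡ (τ^ i) x + (h i + k))

  AffineK⇒Affine : ∀ {f} → AffineK f → Affine f
  AffineK⇒Affine (i , k , _ , f≡) = i , h i + k , f≡

  AffineK-ext : ∀ {f f′} → AffineK f → (∀ x → f x ≡ f′ x) → AffineK f′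
  AffineK-ext (i , k , Kk , f≡) f≗f′ = i , k , Kk , λ x → trans (sym (f≗f′ x)) (f≡ x)

  AffineK-translation : ∀ {k} → K k ≡ true → AffineK (R e k)
  AffineK-translation {k} Kk = 0 , k , Kk , λ x → cong (x +_) (sym (+-identityˡ k))

  AffineK-Rgτ : AffineK (λ x → R e g (τ x))
  AffineK-Rgτ = 1 , 0ᴳ , K-0ᴳ , λ x → cong (τ x +_) (sym (trans (+-identityʳ _) (+-identityˡ g)))

  AffineK-∘ : ∀ {f f′} → AffineK f → AffineK f′ → AffineK (f ∘ f′)
  AffineK-∘ {f} {f′} (i , k , Kk , f≡) (j , k′ , Kk′ , f′≡) =
    i +ℕ j , (τ^ i) k′ + k , K-+ (K-τ^ i Kk′) Kk , λ x → begin
      f (f′ x)                                          ≡⟨ f≡ _ ⟩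
      (τ^ i) (f′ x) + (h i + k)                         ≡⟨ cong (λ z → (τ^ i) z + (h i + k)) (f′≡ x) ⟩
      (τ^ i) ((τ^ j) x + (h j + k′)) + (h i + k)        ≡⟨ cong (_+ (h i + k)) (trans (τ^-hom i _ _) (cong ((τ^ i) ((τ^ j) x) +_) (τ^-hom i _ _))) ⟩
      (τ^ i) ((τ^ j) x) + ((τ^ i) (h j) + (τ^ i) k′) + (h i + k)
        ≡⟨ solve 5 (λ X H′ K′ H K → X ⊞ (H′ ⊞ K′) ⊞ (H ⊞ K) ⊜ X ⊞ (H ⊞ H′ ⊞ (K′ ⊞ K)))
             refl ((τ^ i) ((τ^ j) x)) ((τ^ i) (h j)) ((τ^ i) k′) (h i) k ⟩
      (τ^ i) ((τ^ j) x) + (h i + (τ^ i) (h j) + ((τ^ i) k′ + k))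
        ≡⟨ cong₂ (λ u w → u + (w + ((τ^ i) k′ + k))) (sym (τ^-+ i j x)) (sym (h-+ i j)) ⟩
      (τ^ (i +ℕ j)) x + (h (i +ℕ j) + ((τ^ i) k′ + k)) ∎
    where open ≡-Reasoning

  -- f⁴ is the translation by an element of K, so f⁻¹ = f³ ∘ R(−c).
  AffineK-inverse : ∀ {f} → AffineK f → Σ (G n → G n) λ f′ → IsInverse f f′ × AffineK f′
  AffineK-inverse {f} af@(i , _) = f′ , (f′∘f≡id , f∘f′≡id) , af′
    where
    f³ : G n → G n
    f³ x = f (f (f x))
    af³ : AffineK f³
    af³ = AffineK-∘ af (AffineK-∘ af af)
    af⁴ : AffineK (f ∘ f³)
    af⁴ = AffineK-∘ af af³
    k₄ : G n
    k₄ = proj₁ (proj₂ af⁴)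
    4i≡i*4 : i +ℕ (i +ℕ (i +ℕ i)) ≡ i * 4
    4i≡i*4 = trans (cong (λ m → i +ℕ (i +ℕ (i +ℕ m))) (sym (ℕ.+-identityʳ i))) (ℕ.*-comm 4 i)
    c : G n
    c = h (i * 4) + k₄
    Kc : K c ≡ true
    Kc = K-+ (K-h-*4 i) (proj₁ (proj₂ (proj₂ af⁴)))
    f⁴≡ : ∀ x → f (f³ x) ≡ x + c
    f⁴≡ x = trans (proj₂ (proj₂ (proj₂ af⁴)) x)
      (trans (cong (λ m → (τ^ m) x + (h m + k₄)) 4i≡i*4) (cong (_+ c) (τ^-periodic i x)))
    f′ : G n → G n
    f′ x = f³ (x + - c)
    af′ : AffineK f′
    af′ = AffineK-∘ af³ (AffineK-translation (K-neg Kc))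
    f∘f′≡id : ∀ x → f (f′ x) ≡ x
    f∘f′≡id x = trans (f⁴≡ _) (x-y+y≡x x c)
    f′∘f≡id : ∀ x → f′ (f x) ≡ x
    f′∘f≡id x = proj₁ (affine-isPerm (AffineK⇒Affine af)) _ _ (f∘f′≡id (f x))

  H : (G n → G n) → Set
  H = GKτh e K τ g

  Gen-AffineK : ∀ {f} → H f → AffineK f
  Gen-AffineK (gen (inj₁ (k , Kk , f≡))) = AffineK-ext (AffineK-translation Kk) (λ x → sym (f≡ x))
  Gen-AffineK (gen (inj₂ f≡)) = AffineK-ext AffineK-Rgτ (λ x → sym (f≡ x))
  Gen-AffineK unit = AffineK-ext (AffineK-translation K-0ᴳ) +-identityʳ
  Gen-AffineK (comp p q) = AffineK-∘ (Gen-AffineK p) (Gen-AffineK q)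
  Gen-AffineK (inv {f} {f′} p (_ , f∘f′≡id)) =
    let (f⁻¹ , (f⁻¹∘f≡id , _) , af⁻¹) = AffineK-inverse (Gen-AffineK p) in
    AffineK-ext af⁻¹ (λ x → trans (cong f⁻¹ (sym (f∘f′≡id x))) (f⁻¹∘f≡id (f′ x)))
  Gen-AffineK (ext p f≗f′) = AffineK-ext (Gen-AffineK p) f≗f′

  τ^-rotation : ∀ b i x → (τ^ (rotation b (hClass b i))) x ≡ (τ^ i) x
  τ^-rotation b 0 x = refl
  τ^-rotation true 1 x = refl
  τ^-rotation false 1 x = refl
  τ^-rotation b 2 x = refl
  τ^-rotation true 3 x = refl
  τ^-rotation false 3 x = refl
  τ^-rotation b (suc (suc (suc (suc i)))) x = trans (τ^-rotation b i x) (sym (τ⁴≡id _))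

  -- The index i mod 4 of a K-affine map is read off from the class of its value at 0.
  AffineK-determined : ∀ {φ φ′} → AffineK φ → AffineK φ′ → φ 0ᴳ ≡ φ′ 0ᴳ → ∀ z → φ z ≡ φ′ z
  AffineK-determined {φ} {φ′} (i , k , Kk , φ≡) (j , k′ , Kk′ , φ′≡) φ0≡φ′0 z =
    trans (φ≡ z) (trans (cong₂ _+_ τ^i≡τ^j c≡c′) (sym (φ′≡ z)))
    where
    value-at-0 : ∀ (f : G n → G n) l c → (∀ x → f x ≡ (τ^ l) x + c) → f 0ᴳ ≡ c
    value-at-0 f l c f≡ = trans (f≡ 0ᴳ) (trans (cong (_+ c) (τ^-0ᴳ l)) (+-identityˡ c))
    c≡c′ : h i + k ≡ h j + k′
    c≡c′ = trans (sym (value-at-0 φ i _ φ≡)) (trans φ0≡φ′0 (value-at-0 φ′ j _ φ′≡))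
    classes : hClass χg i ≡ hClass χg j
    classes = trans (sym (ψ-h i)) (trans (sym (ψ-+K (h i) Kk)) (trans (cong ψ c≡c′) (trans (ψ-+K (h j) Kk′) (ψ-h j))))
    τ^i≡τ^j : (τ^ i) z ≡ (τ^ j) z
    τ^i≡τ^j = trans (sym (τ^-rotation χg i z)) (trans (cong (λ r → (τ^ (rotation χg r)) z) classes) (τ^-rotation χg j z))

  Rgτ^ : ℕ → G n → G n
  Rgτ^ zero x = x
  Rgτ^ (suc r) x = R e g (τ (Rgτ^ r x))

  Rgτ^-∈H : ∀ r → H (Rgτ^ r)
  Rgτ^-∈H zero = ext unit (λ _ → refl)
  Rgτ^-∈H (suc r) = ext (comp (gen (inj₂ (λ _ → refl))) (Rgτ^-∈H r)) (λ _ → refl)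

  Rgτ^-0ᴳ : ∀ r → Rgτ^ r 0ᴳ ≡ h r
  Rgτ^-0ᴳ zero = refl
  Rgτ^-0ᴳ (suc r) = trans (cong (λ x → τ x + g) (Rgτ^-0ᴳ r)) (trans (+-comm _ g) (sym (h-suc r)))

  reachIndex : G n → ℕ
  reachIndex z = rotation χg (ψ z)

  K-reachOffset : ∀ z → K (z + - h (reachIndex z)) ≡ true
  K-reachOffset z = ψ≡0⇒K (begin
    ψ (z + - h (reachIndex z))        ≡⟨ ψ-hom z _ ⟩
    ψ z ⊻ ψ (- h (reachIndex z))      ≡⟨ cong (ψ z ⊻_) (trans (ψ-neg _) (trans (ψ-h (reachIndex z)) (hClass-rotation χg (ψ z)))) ⟩
    ψ z ⊻ ψ z                         ≡⟨ ⊻-self (ψ z) ⟩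
    (false , false)                   ∎)
    where open ≡-Reasoning

  reach : G n → G n → G n
  reach z = R e (z + - h (reachIndex z)) ∘ Rgτ^ (reachIndex z)

  reach-∈H : ∀ z → H (reach z)
  reach-∈H z = comp (gen (inj₁ (_ , K-reachOffset z , λ _ → refl))) (Rgτ^-∈H (reachIndex z))

  reach-0ᴳ : ∀ z → reach z 0ᴳ ≡ z
  reach-0ᴳ z = trans (cong (_+ (z + - h r)) (Rgτ^-0ᴳ r)) (trans (+-comm (h r) _) (x-y+y≡x z (h r)))
    where
    r : ℕ
    r = reachIndex z

  H-regular : IsRegular H
  H-regular = transitive , semiregular
    where
    reach⁻¹ : ∀ x → Σ (G n → G n) λ t′ → IsInverse (reach x) t′ × AffineK t′
    reach⁻¹ x = AffineK-inverse (Gen-AffineK (reach-∈H x))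
    transitive : ∀ x y → ∃[ f ] (H f × f x ≡ y)
    transitive x y = let (t′ , t-inv , _) = reach⁻¹ x in
      reach y ∘ t′ , comp (reach-∈H y) (inv (reach-∈H x) t-inv) ,
      trans (cong (reach y ∘ t′) (sym (reach-0ᴳ x))) (trans (cong (reach y) (proj₁ t-inv 0ᴳ)) (reach-0ᴳ y))
    semiregular : ∀ f f′ x → H f → H f′ → f x ≡ f′ x → ∀ z → f z ≡ f′ z
    semiregular f f′ x Hf Hf′ fx≡f′x z = let (t′ , (_ , t∘t′≡id) , _) = reach⁻¹ x in
      trans (cong f (sym (t∘t′≡id z))) (trans
        (AffineK-determined (Gen-AffineK (comp Hf (reach-∈H x))) (Gen-AffineK (comp Hf′ (reach-∈H x)))
          (trans (cong f (reach-0ᴳ x)) (trans fx≡f′x (cong f′ (sym (reach-0ᴳ x))))) (t′ z))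
        (cong f′ (t∘t′≡id z)))

mainTheorem8 : (n : ℕ) → 2 ≤ n → (e : Vec F2 n) → (a : Vec F4 n)
    → (τ : G n → G n) → IsGroupAut e τ → HasOrder4 τ → IsGenIsometry a τ
    → NontrivialOnQuotient e τ
    → Σ (G n → Bool) λ K → Σ (G n) λ h →
    IsSubgroup e K × IsInvariant τ K × HasIndex4 n K
    × (K (hSeq e τ h 4) ≡ true)
    × ¬ (K (hSeq e τ h 1) ≡ true) × ¬ (K (hSeq e τ h 2) ≡ true)
    × ¬ (K (hSeq e τ h 3) ≡ true)
    × IsRegularAutGroup e 3 (D3 a) (GKτh e K τ h)
    × (IsIsometry a τ → IsRegularAutGroup e 4 (D4 a) (GKτh e K τ h))
    × NilClassAtMost 6 (GKτh e K τ h)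
-- The construction does not need n ≥ 2.
mainTheorem8 n _ e a τ (τ-hom , τ-injective , _) (τ⁴≡id , _) τ-Galois (g , τg-g∉W) =
  K , g , K-isSubgroup , K-invariant , K-index4 , K-h₄ , K-h₁ , K-h₂ , K-h₃ ,
  ((λ _ → affine-isSchemeAut₃ a τ-Galois ∘ H-affine) , H-regular) ,
  (λ τ-isometry → (λ _ → affine-isSchemeAut₄ a τ-isometry ∘ H-affine) , H-regular) ,
  affine-nilpotent H-affine
  where
  open Automorphism e τ τ-hom τ-injective τ⁴≡id
  χ-separating : Σ (G n → Bool) λ χ → Characters.IsCharacter e χ
    × χ (addG e (τ g) (negG e g)) ≡ true × (∀ x → χ (τ (τ x)) ≡ χ x)
  χ-separating = τ²-invariant-separatingCharacter τg-g∉W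
  open Construction e τ τ-hom τ-injective τ⁴≡id
    (proj₁ χ-separating) (proj₁ (proj₂ χ-separating)) (proj₂ (proj₂ (proj₂ χ-separating)))
    g (proj₁ (proj₂ (proj₂ χ-separating)))
  H-affine : ∀ {f} → H f → Affine f
  H-affine = AffineK⇒Affine ∘ Gen-AffineK
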